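{- Let $q$ be a power of an odd prime, $\varepsilon=\left(\frac{ -1}{q}\right)$. Let $\tau\in\mathbb{F}_q$ be such that $\tau$ and $\tau+1$ are both nonzero squares, let $r=2(1-\tau)/(1+\tau)$ and let $u\in\overline{\mathbb{F}}_q^\times$ with $u+1/u=r$. Let $c\in\mathbb{F}_q$ be a square root of $1+\tau$ and $c'\in\mathbb{F}_q$ a square root of $1+1/\tau$, and set $\nu=\left(\frac{1\pm1/c}{q}\right)$, $\mu=\left(\frac{1\pm1/c'}{q}\right)$ (these do not depend on the sign). Then $\nu=\left(\frac{2}{q}\right)\mu$; every square root $\sqrt{r+2}\in\mathbb{F}_q$ lies in $\mathcal{A}_{ -2,2}^{\varepsilon\mu,\mu}$; every square root $\sqrt{2-r}\in\mathbb{F}_q$ lies in $\mathcal{A}_{ -2,2}^{\varepsilon\nu,\nu}$; and $u^{(q-\varepsilon)/4}=\mu$.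
   Context: $\mathbb{F}_q$ is the field with $q$ elements, $\overline{\mathbb{F}}_q$ an algebraic closure. For $a\in\mathbb{F}_q$, $\left(\frac{a}{q}\right)$ is the Legendre symbol ($1$ on nonzero squares, $-1$ on nonsquares, $0$ at $0$); $\varepsilon=\left(\frac{ -1}{q}\right)=(-1)^{(q-1)/2}$. For $k\ne\ell$ and $\varepsilon_1,\varepsilon_2\in\{\pm1\}$, $\mathcal{A}_{k,\ell}^{\varepsilon_1,\varepsilon_2}=\{a\in\mathbb{F}_q:\left(\frac{a+k}{q}\right)=\varepsilon_1,\left(\frac{a+\ell}{q}\right)=\varepsilon_2\}$. Under the hypotheses, $r+2=4/(\tau+1)$ and $2-r=4\tau/(\tau+1)$ are nonzero squares in $\mathbb{F}_q$. -}

module Defs where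

open import Level using (0ℓ)
open import Data.Nat as ℕ using (ℕ; zero; suc)
open import Data.Nat.Primality using (Prime)
open import Data.Integer as ℤ using (ℤ; +_; -[1+_])
open import Data.Fin using (Fin)
open import Data.Fin.Properties using (any?)
open import Data.Product using (Σ; ∃; _×_; _,_)
open import Relation.Nullary using (¬_; Dec; yes; no)
open import Relation.Binary.PropositionalEquality using (_≡_; _≢_)
open import Relation.Binary.Definitions using (DecidableEquality)
import Algebra.Structures as S
open import Function.Bundles using (_↔_; Inverse)

-- A field, with propositional equality and decidable equality.
-- _⁻¹ is a total function, required to be a two-sided inverse on nonzero elements.
record Field : Set₁ where
  infixl 6 _+_ _-_
  infixl 7 _*_
  infix  8 -_
  infixl 9 _⁻¹
  infix  4 _≟_
  field
    Carrier : Set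
    _+_ _*_ : Carrier → Carrier → Carrier
    -_ : Carrier → Carrier
    0# 1# : Carrier
    _⁻¹ : Carrier → Carrier
    isCommutativeRing : S.IsCommutativeRing _≡_ _+_ _*_ -_ 0# 1#
    0≢1 : 0# ≢ 1#
    ⁻¹-inverse : ∀ x → x ≢ 0# → x * (x ⁻¹) ≡ 1#
    _≟_ : DecidableEquality Carrier

  _-_ : Carrier → Carrier → Carrier
  x - y = x + (- y)

  fromℕ : ℕ → Carrier
  fromℕ zero    = 0#
  fromℕ (suc n) = 1# + fromℕ n

  fromℤ : ℤ → Carrier
  fromℤ (+ n)    = fromℕ n
  fromℤ -[1+ n ] = - fromℕ (suc n)

  _^_ : Carrier → ℕ → Carrier
  x ^ zero  = 1#
  x ^ suc n = x * (x ^ n)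

record FiniteField (q : ℕ) : Set₁ where
  field
    field′ : Field
  open Field field′ public
  field
    enum : Fin q ↔ Carrier

  isSquare? : (a : Carrier) → Dec (∃ λ (i : Fin q) → Inverse.to enum i * Inverse.to enum i ≡ a)
  isSquare? a = any? (λ i → Inverse.to enum i * Inverse.to enum i ≟ a)

  legendre : Carrier → ℤ
  legendre a with a ≟ 0#
  ... | yes _ = + 0
  ... | no  _ with isSquare? a
  ...   | yes _ = + 1
  ...   | no  _ = ℤ.- (+ 1)

  𝒜 : (k ℓ : Carrier) (ε₁ ε₂ : ℤ) → Carrier → Set
  𝒜 k ℓ ε₁ ε₂ a = (legendre (a + k) ≡ ε₁) × (legendre (a + ℓ) ≡ ε₂)

IsOddPrimePower : ℕ → Set
IsOddPrimePower q = Σ ℕ λ p → Σ ℕ λ k → Prime p × (p ≢ 2) × (1 ℕ.≤ k) × (q ≡ p ℕ.^ k)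

-- A field homomorphism ι : K → L (preserves +, *, 1); L is then an extension of K
record FieldHom (K L : Field) : Set where
  private
    module K = Field K
    module L = Field L
  field
    ι : K.Carrier → L.Carrier
    ι-+ : ∀ x y → ι (x K.+ y) ≡ ι x L.+ ι y
    ι-* : ∀ x y → ι (x K.* y) ≡ ι x L.* ι y
    ι-1 : ι K.1# ≡ L.1#

{-# OPTIONS --safe #-}
module Submission where

-- Put a = 1/c and b = 1/c′. Then a² + b² = 1 and r = 2(a² − b²), so that r + 2 = (2a)²,
-- 2 − r = (2b)², (1 − a)(1 + a) = b², (1 − b)(1 + b) = a² and 2(1 + a)(1 + b) = (1 + a + b)²;
-- multiplicativity of the Legendre symbol turns these identities into the claims on ν, μ and 𝒜.
--
-- For the last claim let i be a square root of −1 in L. Then u = (a + bi)², and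
-- w = (1 + a + b) + (1 − a + b) i satisfies w² = g (a + bi) with g = 4(1 + b) ∈ 𝔽_q, so u g² = w⁴,
-- while g^((q−1)/2) = ((1 + b)/q) = μ by Euler's criterion. Frobenius fixes 𝔽_q and sends i to εi,
-- hence w^(q−1) = 1 if ε = 1 and w^(q+1) = w w̄ = g if ε = −1; either way u^((q−ε)/4) = μ.
-- Euler's criterion, like Wilson's theorem, comes from Dirichlet's pairing of x with a/x.

open import Defs
open import Level using (0ℓ)
open import Data.Nat as ℕ using (ℕ; zero; suc)
import Data.Nat.Properties as ℕ
import Data.Integer.Properties as ℤ
open import Data.Integer as ℤ using (ℤ; +_; -[1+_]; ∣_∣)
open import Data.Product using (Σ; _×_; _,_; proj₁; proj₂)
open import Data.Sum using (_⊎_; inj₁; inj₂)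
open import Data.Empty using (⊥-elim)
open import Relation.Nullary using (¬_; yes; no)
open import Relation.Binary.PropositionalEquality
open import Algebra.Bundles using (CommutativeRing; Semiring)
import Algebra.Structures as S
open import Algebra.Structures using (IsCommutativeMonoid)
open import Algebra.Solver.Ring.AlmostCommutativeRing using (fromCommutativeRing; _-Raw-AlmostCommutative⟶_)
import Algebra.Solver.Ring as RingSolver
import Algebra.Properties.Ring as RingProperties
import Algebra.Properties.AbelianGroup as AbelianGroupProperties
import Algebra.Properties.CommutativeSemigroup as CommutativeSemigroupProperties
open import Data.Maybe using (Maybe; just; nothing)
open import Data.List using (List; []; _∷_; length; map; foldr; allFin)
open import Data.List.Properties using (length-map; length-tabulate)
open import Data.List.Membership.Propositional.Properties using (∈-map⁺; ∈-allFin)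
open import Data.List.Relation.Unary.Unique.Propositional.Properties using (map⁺; allFin⁺)
open import Function.Bundles using (Inverse)
open import Data.List.Relation.Unary.Any using (here; there)
open import Data.List.Relation.Unary.All.Properties using (All¬⇒¬Any; ¬Any⇒All¬)
open import Data.List.Relation.Unary.AllPairs using (_∷_)
open import Data.List.Membership.Propositional using (_∈_; _∉_)
open import Data.List.Relation.Unary.Unique.Propositional using (Unique)
open import Relation.Binary.Definitions using (DecidableEquality)
open import Data.Nat.Divisibility using (_∣_; divides; ∣1⇒≡1; ∣⇒≤)
open import Data.Nat.DivMod using (m/n*n≡m; m*n/n≡m)
open import Data.Nat.Tactic.RingSolver using (solve-∀)
open import Data.Nat.Combinatorics using (_C_; nCn≡1; k![n∸k]!∣n!)
open import Data.Nat.Combinatorics.Specification using (nCk≡n!/k![n-k]!)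
open import Data.Nat.Primality using (Prime; euclidsLemma; prime[2]; prime⇒nonTrivial; prime⇒nonZero; composite-≢)
open import Data.Fin as Fin using (Fin; toℕ; inject₁)
open import Data.Fin.Properties using (toℕ-fromℕ; toℕ-inject₁; toℕ<n)
import Algebra.Properties.CommutativeSemiring.Binomial as Binomial
import Algebra.Definitions.RawSemiring as RawSemiringDefinitions

-- Elementary arithmetic

data Sign : ℤ → Set where
  plus : Sign (+ 1)
  minus : Sign -[1+ 0 ]

Sign-* : ∀ {s t} → Sign s → Sign t → Sign (s ℤ.* t)
Sign-* plus plus = plus
Sign-* plus minus = minus
Sign-* minus plus = minus
Sign-* minus minus = plus

Sign-*-cancelˡ : ∀ {s} → Sign s → ∀ t → s ℤ.* (s ℤ.* t) ≡ t
Sign-*-cancelˡ plus t = trans (ℤ.*-identityˡ _) (ℤ.*-identityˡ t)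
Sign-*-cancelˡ minus t = trans (sym (ℤ.*-assoc -[1+ 0 ] -[1+ 0 ] t)) (ℤ.*-identityˡ t)

Sign-*≡1⇒≡ : ∀ {s t} → Sign s → Sign t → s ℤ.* t ≡ + 1 → s ≡ t
Sign-*≡1⇒≡ plus  plus  _  = refl
Sign-*≡1⇒≡ minus minus _  = refl
Sign-*≡1⇒≡ plus  minus ()
Sign-*≡1⇒≡ minus plus  ()

even⊎odd : ∀ n → (Σ ℕ λ h → n ≡ 2 ℕ.* h) ⊎ (Σ ℕ λ h → n ≡ suc (2 ℕ.* h))
even⊎odd zero = inj₁ (0 , refl)
even⊎odd (suc n) with even⊎odd n
... | inj₁ (h , refl) = inj₂ (h , refl)
... | inj₂ (h , refl) = inj₁ (suc h , sym (ℕ.*-suc 2 h))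

¬2∣n⇒odd : ∀ {n} → ¬ (2 ∣ n) → Σ ℕ λ h → n ≡ suc (2 ℕ.* h)
¬2∣n⇒odd {n} 2∤n with even⊎odd n
... | inj₁ (h , n≡2h) = ⊥-elim (2∤n (divides h (trans n≡2h (ℕ.*-comm 2 h))))
... | inj₂ odd        = odd

nCk*[k!*[n∸k]!]≡n! : ∀ {n k} → k ℕ.≤ n → (n C k) ℕ.* (k ℕ.! ℕ.* (n ℕ.∸ k) ℕ.!) ≡ n ℕ.!
nCk*[k!*[n∸k]!]≡n! {n} {k} k≤n = trans (cong (ℕ._* (k ℕ.! ℕ.* (n ℕ.∸ k) ℕ.!)) (nCk≡n!/k![n-k]! k≤n))
  (m/n*n≡m {{ℕ._!*_!≢0 k (n ℕ.∸ k)}} (k![n∸k]!∣n! k≤n))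

module _ {p} (p-prime : Prime p) where

  private
    p>1 : 1 ℕ.< p
    p>1 = ℕ.nonTrivial⇒n>1 p {{prime⇒nonTrivial p-prime}}

    p∣p! : p ∣ p ℕ.!
    p∣p! = subst (λ n → n ∣ n ℕ.!) (ℕ.suc-pred p {{prime⇒nonZero p-prime}})
      (divides (ℕ.pred p ℕ.!) (ℕ.*-comm (suc (ℕ.pred p)) (ℕ.pred p ℕ.!)))

  prime∤n! : ∀ n → n ℕ.< p → ¬ (p ∣ n ℕ.!)
  prime∤n! zero    _   p∣1 with ∣1⇒≡1 p∣1
  ... | refl = ℕ.<-irrefl refl p>1
  prime∤n! (suc n) n<p p∣n! with euclidsLemma (suc n) (n ℕ.!) p-prime p∣n!
  ... | inj₁ p∣1+n = ℕ.<-irrefl refl (ℕ.<-≤-trans n<p (∣⇒≤ p∣1+n))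
  ... | inj₂ p∣n!  = prime∤n! n (ℕ.<-trans (ℕ.n<1+n n) n<p) p∣n!

  odd-prime∤2 : p ≢ 2 → ¬ (2 ∣ p)
  odd-prime∤2 p≢2 2∣p = Prime.notComposite p-prime
    (composite-≢ 2 {{_}} {{prime⇒nonZero p-prime}} (λ 2≡p → p≢2 (sym 2≡p)) 2∣p)

  odd-prime^k∤2 : p ≢ 2 → ∀ k → ¬ (2 ∣ p ℕ.^ k)
  odd-prime^k∤2 p≢2 zero    2∣1 with ∣1⇒≡1 2∣1
  ... | ()
  odd-prime^k∤2 p≢2 (suc k) 2∣p^[1+k] with euclidsLemma p (p ℕ.^ k) prime[2] 2∣p^[1+k]
  ... | inj₁ 2∣p   = odd-prime∤2 p≢2 2∣p
  ... | inj₂ 2∣p^k = odd-prime^k∤2 p≢2 k 2∣p^k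

  prime∣pCj : ∀ {j} → 1 ℕ.≤ j → j ℕ.< p → p ∣ (p C j)
  prime∣pCj {j} 1≤j j<p
    with euclidsLemma (p C j) (j ℕ.! ℕ.* (p ℕ.∸ j) ℕ.!) p-prime
           (subst (p ∣_) (sym (nCk*[k!*[n∸k]!]≡n! (ℕ.<⇒≤ j<p))) p∣p!)
  ... | inj₁ p∣pCj = p∣pCj
  ... | inj₂ p∣j!*[p-j]! with euclidsLemma (j ℕ.!) ((p ℕ.∸ j) ℕ.!) p-prime p∣j!*[p-j]!
  ...   | inj₁ p∣j!     = ⊥-elim (prime∤n! j j<p p∣j!)
  ...   | inj₂ p∣[p-j]! = ⊥-elim (prime∤n! (p ℕ.∸ j) (ℕ.∸-monoʳ-< {p} {j} {0} 1≤j (ℕ.<⇒≤ j<p)) p∣[p-j]!)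

∣[1+4j]-1∣/4≡j : ∀ j → ∣ + suc (2 ℕ.* (2 ℕ.* j)) ℤ.- + 1 ∣ ℕ./ 4 ≡ j
∣[1+4j]-1∣/4≡j j = begin
  ∣ + suc (2 ℕ.* (2 ℕ.* j)) ℤ.- + 1 ∣ ℕ./ 4    ≡⟨ cong (λ i → ∣ i ∣ ℕ./ 4) (ℤ.[1+m]⊖[1+n]≡m⊖n (2 ℕ.* (2 ℕ.* j)) 0) ⟩
  2 ℕ.* (2 ℕ.* j) ℕ./ 4                       ≡⟨ cong (ℕ._/ 4) (2[2j]≡j*4 j) ⟩
  j ℕ.* 4 ℕ./ 4                                ≡⟨ m*n/n≡m j 4 ⟩
  j                                            ∎
  where
  open ≡-Reasoning
  2[2j]≡j*4 : ∀ n → 2 ℕ.* (2 ℕ.* n) ≡ n ℕ.* 4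
  2[2j]≡j*4 = solve-∀

∣[3+4j]+1∣/4≡1+j : ∀ j → ∣ + suc (2 ℕ.* suc (2 ℕ.* j)) ℤ.- -[1+ 0 ] ∣ ℕ./ 4 ≡ suc j
∣[3+4j]+1∣/4≡1+j j = trans (cong (ℕ._/ 4) (3+4j+1≡[1+j]*4 j)) (m*n/n≡m (suc j) 4)
  where
  3+4j+1≡[1+j]*4 : ∀ n → suc (2 ℕ.* suc (2 ℕ.* n)) ℕ.+ 1 ≡ suc n ℕ.* 4
  3+4j+1≡[1+j]*4 = solve-∀

-- Fields

module FieldProperties (K : Field) where
  open Field K public
  open S.IsCommutativeRing isCommutativeRing public
    using (+-assoc; +-comm; +-identityˡ; +-identityʳ; -‿inverseˡ; -‿inverseʳ;
           *-assoc; *-comm; *-identityˡ; *-identityʳ; distribʳ; zeroˡ; zeroʳ)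

  commutativeRing : CommutativeRing 0ℓ 0ℓ
  commutativeRing = record { isCommutativeRing = isCommutativeRing }

  open RingProperties (CommutativeRing.ring commutativeRing) using (-‿distribˡ-*)
  open AbelianGroupProperties (CommutativeRing.+-abelianGroup commutativeRing)
    using (⁻¹-∙-comm) renaming (⁻¹-involutive to -‿involutive; ε⁻¹≈ε to -0≡0)
  open CommutativeSemigroupProperties (CommutativeRing.+-commutativeSemigroup commutativeRing)
    using () renaming (interchange to +-interchange)

  fromℕ-+ : ∀ m n → fromℕ (m ℕ.+ n) ≡ fromℕ m + fromℕ n
  fromℕ-+ zero    n = sym (+-identityˡ _)
  fromℕ-+ (suc m) n = trans (cong (_+_ 1#) (fromℕ-+ m n)) (sym (+-assoc _ _ _))

  fromℕ-* : ∀ m n → fromℕ (m ℕ.* n) ≡ fromℕ m * fromℕ n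
  fromℕ-* zero    n = sym (zeroˡ _)
  fromℕ-* (suc m) n = begin
    fromℕ (n ℕ.+ m ℕ.* n)            ≡⟨ fromℕ-+ n (m ℕ.* n) ⟩
    fromℕ n + fromℕ (m ℕ.* n)        ≡⟨ cong₂ _+_ (sym (*-identityˡ _)) (fromℕ-* m n) ⟩
    1# * fromℕ n + fromℕ m * fromℕ n ≡⟨ distribʳ _ _ _ ⟨
    (1# + fromℕ m) * fromℕ n         ∎
    where open ≡-Reasoning

  fromℤ-neg : ∀ i → fromℤ (ℤ.- i) ≡ - fromℤ i
  fromℤ-neg (+ zero)  = sym -0≡0
  fromℤ-neg (+ suc n) = refl
  fromℤ-neg -[1+ n ]  = sym (-‿involutive _)

  fromℤ-⊖ : ∀ m n → fromℤ (m ℤ.⊖ n) ≡ fromℕ m - fromℕ n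
  fromℤ-⊖ zero    zero    = sym (-‿inverseʳ 0#)
  fromℤ-⊖ (suc m) zero    = sym (trans (cong (_+_ (fromℕ (suc m))) -0≡0) (+-identityʳ _))
  fromℤ-⊖ zero    (suc n) = sym (+-identityˡ _)
  fromℤ-⊖ (suc m) (suc n) = begin
    fromℤ (suc m ℤ.⊖ suc n)               ≡⟨ cong fromℤ (ℤ.[1+m]⊖[1+n]≡m⊖n m n) ⟩
    fromℤ (m ℤ.⊖ n)                       ≡⟨ fromℤ-⊖ m n ⟩
    fromℕ m + - fromℕ n                   ≡⟨ +-identityˡ _ ⟨
    0# + (fromℕ m + - fromℕ n)            ≡⟨ cong (_+ (fromℕ m + - fromℕ n)) (-‿inverseʳ 1#) ⟨
    (1# + - 1#) + (fromℕ m + - fromℕ n)   ≡⟨ +-interchange _ _ _ _ ⟩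
    (1# + fromℕ m) + (- 1# + - fromℕ n)   ≡⟨ cong (_+_ (1# + fromℕ m)) (⁻¹-∙-comm _ _) ⟩
    (1# + fromℕ m) + - (1# + fromℕ n)     ∎
    where open ≡-Reasoning

  fromℤ-+ : ∀ i j → fromℤ (i ℤ.+ j) ≡ fromℤ i + fromℤ j
  fromℤ-+ (+ m)    (+ n)    = fromℕ-+ m n
  fromℤ-+ (+ m)    -[1+ n ] = fromℤ-⊖ m (suc n)
  fromℤ-+ -[1+ m ] (+ n)    = trans (fromℤ-⊖ n (suc m)) (+-comm _ _)
  fromℤ-+ -[1+ m ] -[1+ n ] = begin
    - fromℕ (suc (suc (m ℕ.+ n)))       ≡⟨ cong (λ k → - fromℕ (suc k)) (ℕ.+-suc m n) ⟨
    - fromℕ (suc m ℕ.+ suc n)           ≡⟨ cong -_ (fromℕ-+ (suc m) (suc n)) ⟩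
    - (fromℕ (suc m) + fromℕ (suc n))   ≡⟨ ⁻¹-∙-comm _ _ ⟨
    - fromℕ (suc m) + - fromℕ (suc n)   ∎
    where open ≡-Reasoning

  fromℤ-+-* : ∀ m j → fromℤ (+ m ℤ.* j) ≡ fromℕ m * fromℤ j
  fromℤ-+-* zero    j = sym (zeroˡ _)
  fromℤ-+-* (suc m) j = begin
    fromℤ (+ suc m ℤ.* j)             ≡⟨ cong fromℤ (ℤ.suc-* (+ m) j) ⟩
    fromℤ (j ℤ.+ + m ℤ.* j)           ≡⟨ fromℤ-+ j (+ m ℤ.* j) ⟩
    fromℤ j + fromℤ (+ m ℤ.* j)       ≡⟨ cong₂ _+_ (sym (*-identityˡ _)) (fromℤ-+-* m j) ⟩
    1# * fromℤ j + fromℕ m * fromℤ j  ≡⟨ distribʳ _ _ _ ⟨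
    (1# + fromℕ m) * fromℤ j          ∎
    where open ≡-Reasoning

  fromℤ-* : ∀ i j → fromℤ (i ℤ.* j) ≡ fromℤ i * fromℤ j
  fromℤ-* (+ m)    j = fromℤ-+-* m j
  fromℤ-* -[1+ m ] j = begin
    fromℤ (-[1+ m ] ℤ.* j)             ≡⟨ cong fromℤ (ℤ.neg-distribˡ-* (+ suc m) j) ⟨
    fromℤ (ℤ.- (+ suc m ℤ.* j))        ≡⟨ fromℤ-neg (+ suc m ℤ.* j) ⟩
    - fromℤ (+ suc m ℤ.* j)            ≡⟨ cong -_ (fromℤ-+-* (suc m) j) ⟩
    - (fromℕ (suc m) * fromℤ j)        ≡⟨ -‿distribˡ-* _ _ ⟩
    - fromℕ (suc m) * fromℤ j          ∎
    where open ≡-Reasoning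

  -- The solver's coefficient map: fromℤ, but with the constant 1 read as 1# rather than 1# + 0#.
  coefficient : ℤ → Carrier
  coefficient (+ 1) = 1#
  coefficient i     = fromℤ i

  coefficient≡fromℤ : ∀ i → coefficient i ≡ fromℤ i
  coefficient≡fromℤ (+ 0)           = refl
  coefficient≡fromℤ (+ 1)           = sym (+-identityʳ 1#)
  coefficient≡fromℤ (+ suc (suc n)) = refl
  coefficient≡fromℤ -[1+ n ]        = refl

  coefficient-homomorphism : ℤ.+-*-rawRing -Raw-AlmostCommutative⟶ fromCommutativeRing commutativeRing
  coefficient-homomorphism = record
    { ⟦_⟧    = coefficient
    ; +-homo = λ i j → via (ℤ._+_ i j) (fromℤ-+ i j) (cong₂ _+_ (coefficient≡fromℤ i) (coefficient≡fromℤ j))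
    ; *-homo = λ i j → via (ℤ._*_ i j) (fromℤ-* i j) (cong₂ _*_ (coefficient≡fromℤ i) (coefficient≡fromℤ j))
    ; -‿homo = λ i → via (ℤ.- i) (fromℤ-neg i) (cong -_ (coefficient≡fromℤ i))
    ; 0-homo = refl
    ; 1-homo = refl
    }
    where
    via : ∀ i {x y} → fromℤ i ≡ x → y ≡ x → coefficient i ≡ y
    via i i≡x y≡x = trans (coefficient≡fromℤ i) (trans i≡x (sym y≡x))

  coefficient-≟ : ∀ i j → Maybe (coefficient i ≡ coefficient j)
  coefficient-≟ i j with i ℤ.≟ j
  ... | yes refl = just refl
  ... | no  _    = nothing

  open RingSolver ℤ.+-*-rawRing (fromCommutativeRing commutativeRing) coefficient-homomorphism coefficient-≟
    public using (solve; Polynomial; _:=_; _:+_; _:-_; _:*_; :-_; con)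

  :0 :1 :2 : ∀ {n} → Polynomial n
  :0 = con (+ 0)
  :1 = con (+ 1)
  :2 = :1 :+ :1

  -- The solver cannot use hypotheses: x ≡ y under l ≡ r is reduced to
  -- the polynomial identity x ≡ y + k * (l - r).
  linear-combination : ∀ {x y l r} k → x ≡ y + k * (l - r) → l ≡ r → x ≡ y
  linear-combination {y = y} {l} k x≡ refl =
    trans x≡ (solve 3 (λ y k l → y :+ k :* (l :- l) := y) refl y k l)

  linear-combination₂ : ∀ {x y l₁ r₁ l₂ r₂} k₁ k₂ →
    x ≡ y + k₁ * (l₁ - r₁) + k₂ * (l₂ - r₂) → l₁ ≡ r₁ → l₂ ≡ r₂ → x ≡ y
  linear-combination₂ {y = y} {l₁} {l₂ = l₂} k₁ k₂ x≡ refl refl = trans x≡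
    (solve 5 (λ y k₁ l₁ k₂ l₂ → y :+ k₁ :* (l₁ :- l₁) :+ k₂ :* (l₂ :- l₂) := y) refl y k₁ l₁ k₂ l₂)


  linear-combination₃ : ∀ {x y l₁ r₁ l₂ r₂ l₃ r₃} k₁ k₂ k₃ →
    x ≡ y + k₁ * (l₁ - r₁) + k₂ * (l₂ - r₂) + k₃ * (l₃ - r₃) → l₁ ≡ r₁ → l₂ ≡ r₂ → l₃ ≡ r₃ → x ≡ y
  linear-combination₃ {y = y} {l₁} {l₂ = l₂} {l₃ = l₃} k₁ k₂ k₃ x≡ refl refl refl = trans x≡
    (solve 7 (λ y k₁ l₁ k₂ l₂ k₃ l₃ → y :+ k₁ :* (l₁ :- l₁) :+ k₂ :* (l₂ :- l₂) :+ k₃ :* (l₃ :- l₃) := y)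
      refl y k₁ l₁ k₂ l₂ k₃ l₃)

  1≢0 : 1# ≢ 0#
  1≢0 e = 0≢1 (sym e)

  ⁻¹-inverseˡ : ∀ x → x ≢ 0# → x ⁻¹ * x ≡ 1#
  ⁻¹-inverseˡ x x≢0 = trans (*-comm _ _) (⁻¹-inverse x x≢0)

  *-cancelˡ : ∀ {x y z} → x ≢ 0# → x * y ≡ x * z → y ≡ z
  *-cancelˡ {x} {y} {z} x≢0 e = begin
    y               ≡⟨ *-identityˡ y ⟨
    1# * y          ≡⟨ cong (_* y) (⁻¹-inverseˡ x x≢0) ⟨
    x ⁻¹ * x * y    ≡⟨ *-assoc _ _ _ ⟩
    x ⁻¹ * (x * y)  ≡⟨ cong (_*_ (x ⁻¹)) e ⟩
    x ⁻¹ * (x * z)  ≡⟨ *-assoc _ _ _ ⟨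
    x ⁻¹ * x * z    ≡⟨ cong (_* z) (⁻¹-inverseˡ x x≢0) ⟩
    1# * z          ≡⟨ *-identityˡ z ⟩
    z               ∎
    where open ≡-Reasoning

  x*y≡0⇒x≡0⊎y≡0 : ∀ x y → x * y ≡ 0# → x ≡ 0# ⊎ y ≡ 0#
  x*y≡0⇒x≡0⊎y≡0 x y xy≡0 with x ≟ 0#
  ... | yes x≡0 = inj₁ x≡0
  ... | no  x≢0 = inj₂ (*-cancelˡ x≢0 (trans xy≡0 (sym (zeroʳ x))))

  x*y≢0 : ∀ {x y} → x ≢ 0# → y ≢ 0# → x * y ≢ 0#
  x*y≢0 {x} {y} x≢0 y≢0 xy≡0 with x*y≡0⇒x≡0⊎y≡0 x y xy≡0
  ... | inj₁ x≡0 = x≢0 x≡0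
  ... | inj₂ y≡0 = y≢0 y≡0

  x*y≢0⇒x≢0 : ∀ {x y} → x * y ≢ 0# → x ≢ 0#
  x*y≢0⇒x≢0 {y = y} xy≢0 refl = xy≢0 (zeroˡ y)

  x*y≢0⇒y≢0 : ∀ {x y} → x * y ≢ 0# → y ≢ 0#
  x*y≢0⇒y≢0 {x} xy≢0 refl = xy≢0 (zeroʳ x)

  x⁻¹≢0 : ∀ {x} → x ≢ 0# → x ⁻¹ ≢ 0#
  x⁻¹≢0 {x} x≢0 x⁻¹≡0 = 0≢1 (begin
    0#          ≡⟨ zeroʳ x ⟨
    x * 0#      ≡⟨ cong (_*_ x) x⁻¹≡0 ⟨
    x * x ⁻¹    ≡⟨ ⁻¹-inverse x x≢0 ⟩
    1#          ∎)
    where open ≡-Reasoning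

  -x≢0 : ∀ {x} → x ≢ 0# → - x ≢ 0#
  -x≢0 {x} x≢0 -x≡0 = x≢0 (linear-combination (- 1#)
    (solve 1 (λ x → x := :0 :+ (:- :1) :* (:- x :- :0)) refl x) -x≡0)

  -1≢0 : - 1# ≢ 0#
  -1≢0 = -x≢0 1≢0

  ⁻¹-unique : ∀ {x y} → x * y ≡ 1# → y ≡ x ⁻¹
  ⁻¹-unique {x} {y} xy≡1 with x ≟ 0#
  ... | yes refl = ⊥-elim (0≢1 (trans (sym (zeroˡ y)) xy≡1))
  ... | no  x≢0  = *-cancelˡ x≢0 (trans xy≡1 (sym (⁻¹-inverse x x≢0)))

  ⁻¹-involutive : ∀ {x} → x ≢ 0# → x ⁻¹ ⁻¹ ≡ x
  ⁻¹-involutive {x} x≢0 = sym (⁻¹-unique (⁻¹-inverseˡ x x≢0))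

  x*y≡z⇒x≡z*y⁻¹ : ∀ {x y z} → y ≢ 0# → x * y ≡ z → x ≡ z * y ⁻¹
  x*y≡z⇒x≡z*y⁻¹ {x} {y} {z} y≢0 xy≡z = linear-combination₂ (y ⁻¹) (- x)
    (solve 4 (λ x y z y' → x := z :* y' :+ y' :* (x :* y :- z) :+ :- x :* (y :* y' :- :1)) refl x y z (y ⁻¹))
    xy≡z (⁻¹-inverse y y≢0)

  ⁻¹-distrib-* : ∀ {x y} → x ≢ 0# → y ≢ 0# → (x * y) ⁻¹ ≡ x ⁻¹ * y ⁻¹
  ⁻¹-distrib-* {x} {y} x≢0 y≢0 = sym (⁻¹-unique (linear-combination₂ (y * y ⁻¹) 1#
    (solve 4 (λ x y x' y' → x :* y :* (x' :* y') := :1 :+ y :* y' :* (x :* x' :- :1) :+ :1 :* (y :* y' :- :1))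
      refl x y (x ⁻¹) (y ⁻¹))
    (⁻¹-inverse x x≢0) (⁻¹-inverse y y≢0)))

  x+y≡x*y⇒x⁻¹+y⁻¹≡1 : ∀ {x y} → x ≢ 0# → y ≢ 0# → x + y ≡ x * y → x ⁻¹ + y ⁻¹ ≡ 1#
  x+y≡x*y⇒x⁻¹+y⁻¹≡1 {x} {y} x≢0 y≢0 x+y≡xy = linear-combination₃ (x ⁻¹ * y ⁻¹) (y * y ⁻¹ - y ⁻¹) (1# - x ⁻¹)
    (solve 4 (λ x y x' y' → x' :+ y' := :1 :+ x' :* y' :* ((x :+ y) :- x :* y)
                :+ (y :* y' :- y') :* (x :* x' :- :1) :+ (:1 :- x') :* (y :* y' :- :1)) refl x y (x ⁻¹) (y ⁻¹))
    x+y≡xy (⁻¹-inverse x x≢0) (⁻¹-inverse y y≢0)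

  x*x≡y*y⇒x≡±y : ∀ {x y} → x * x ≡ y * y → x ≡ y ⊎ x ≡ - y
  x*x≡y*y⇒x≡±y {x} {y} x²≡y²
    with x*y≡0⇒x≡0⊎y≡0 (x - y) (x + y) (linear-combination 1#
      (solve 2 (λ x y → (x :- y) :* (x :+ y) := :0 :+ :1 :* (x :* x :- y :* y)) refl x y) x²≡y²)
  ... | inj₁ x-y≡0 = inj₁ (linear-combination 1#
          (solve 2 (λ x y → x := y :+ :1 :* ((x :- y) :- :0)) refl x y) x-y≡0)
  ... | inj₂ x+y≡0 = inj₂ (linear-combination 1#
          (solve 2 (λ x y → x := :- y :+ :1 :* ((x :+ y) :- :0)) refl x y) x+y≡0)

  ^-distribˡ-+-* : ∀ x m n → x ^ (m ℕ.+ n) ≡ x ^ m * x ^ n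
  ^-distribˡ-+-* x zero    n = sym (*-identityˡ _)
  ^-distribˡ-+-* x (suc m) n = trans (cong (_*_ x) (^-distribˡ-+-* x m n)) (sym (*-assoc _ _ _))

  ^-*-assoc : ∀ x m n → (x ^ m) ^ n ≡ x ^ (m ℕ.* n)
  ^-*-assoc x m zero    = cong (x ^_) (sym (ℕ.*-zeroʳ m))
  ^-*-assoc x m (suc n) = begin
    x ^ m * (x ^ m) ^ n      ≡⟨ cong (_*_ (x ^ m)) (^-*-assoc x m n) ⟩
    x ^ m * x ^ (m ℕ.* n)    ≡⟨ ^-distribˡ-+-* x m (m ℕ.* n) ⟨
    x ^ (m ℕ.+ m ℕ.* n)      ≡⟨ cong (x ^_) (ℕ.*-suc m n) ⟨
    x ^ (m ℕ.* suc n)        ∎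
    where open ≡-Reasoning

  ^-distribʳ-* : ∀ x y n → (x * y) ^ n ≡ x ^ n * y ^ n
  ^-distribʳ-* x y zero    = sym (*-identityˡ _)
  ^-distribʳ-* x y (suc n) = trans (cong (_*_ (x * y)) (^-distribʳ-* x y n))
    (solve 4 (λ x y a b → x :* y :* (a :* b) := x :* a :* (y :* b)) refl x y (x ^ n) (y ^ n))

  ^-zeroˡ : ∀ n → 1# ^ n ≡ 1#
  ^-zeroˡ zero    = refl
  ^-zeroˡ (suc n) = trans (*-identityˡ _) (^-zeroˡ n)

  x^n≢0 : ∀ {x} n → x ≢ 0# → x ^ n ≢ 0#
  x^n≢0 zero    x≢0 = 1≢0
  x^n≢0 (suc n) x≢0 = x*y≢0 x≢0 (x^n≢0 n x≢0)

  fromℕ-^ : ∀ m n → fromℕ (m ℕ.^ n) ≡ fromℕ m ^ n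
  fromℕ-^ m zero    = +-identityʳ 1#
  fromℕ-^ m (suc n) = trans (fromℕ-* m (m ℕ.^ n)) (cong (_*_ (fromℕ m)) (fromℕ-^ m n))

  x*x≡-1⇒x^[4*j]≡1 : ∀ {x} → x * x ≡ - 1# → ∀ j → x ^ (4 ℕ.* j) ≡ 1#
  x*x≡-1⇒x^[4*j]≡1 {x} x²≡-1 j = begin
    x ^ (4 ℕ.* j)        ≡⟨ ^-*-assoc x 4 j ⟨
    (x ^ 4) ^ j          ≡⟨ cong (_^ j) x⁴≡1 ⟩
    1# ^ j               ≡⟨ ^-zeroˡ j ⟩
    1#                   ∎
    where
    open ≡-Reasoning
    x⁴≡1 : x ^ 4 ≡ 1#
    x⁴≡1 = linear-combination (x * x - 1#)
      (solve 1 (λ x → x :* (x :* (x :* (x :* :1))) := :1 :+ (x :* x :- :1) :* (x :* x :- :- :1)) refl x) x²≡-1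

  fromℤ-sign² : ∀ {s} → Sign s → fromℤ s * fromℤ s ≡ 1#
  fromℤ-sign² plus  = solve 0 ((:1 :+ :0) :* (:1 :+ :0) := :1) refl
  fromℤ-sign² minus = solve 0 (:- (:1 :+ :0) :* :- (:1 :+ :0) := :1) refl

  x*s≡1⇒x≡s : ∀ {x s} → Sign s → x * fromℤ s ≡ 1# → x ≡ fromℤ s
  x*s≡1⇒x≡s {x} {s} sign xs≡1 = linear-combination₂ (fromℤ s) (- x)
    (solve 2 (λ x s → x := s :+ s :* (x :* s :- :1) :+ :- x :* (s :* s :- :1)) refl x (fromℤ s))
    xs≡1 (fromℤ-sign² sign)

  fromℤ-injective-on-signs : 1# + 1# ≢ 0# → ∀ {s t} → Sign s → Sign t → fromℤ s ≡ fromℤ t → s ≡ t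
  fromℤ-injective-on-signs 2≢0 plus  plus  _ = refl
  fromℤ-injective-on-signs 2≢0 minus minus _ = refl
  fromℤ-injective-on-signs 2≢0 plus  minus e = ⊥-elim (2≢0 (linear-combination 1#
    (solve 0 (:2 := :0 :+ :1 :* ((:1 :+ :0) :- :- (:1 :+ :0))) refl) e))
  fromℤ-injective-on-signs 2≢0 minus plus  e = ⊥-elim (2≢0 (linear-combination (- 1#)
    (solve 0 (:2 := :0 :+ :- :1 :* (:- (:1 :+ :0) :- (:1 :+ :0))) refl) e))

  [x*x]^e≡x^[2*e] : ∀ x e → (x * x) ^ e ≡ x ^ (2 ℕ.* e)
  [x*x]^e≡x^[2*e] x e = begin
    (x * x) ^ e          ≡⟨ ^-distribʳ-* x x e ⟩
    x ^ e * x ^ e        ≡⟨ ^-distribˡ-+-* x e e ⟨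
    x ^ (e ℕ.+ e)        ≡⟨ cong (x ^_) (cong (e ℕ.+_) (ℕ.+-identityʳ e)) ⟨
    x ^ (2 ℕ.* e)        ∎
    where open ≡-Reasoning

  x[y*y]≡[z*z][z*z]⇒x^e*y^[2e]≡z^[4e] : ∀ {x y z} → x * (y * y) ≡ (z * z) * (z * z) →
    ∀ e → x ^ e * y ^ (2 ℕ.* e) ≡ z ^ (4 ℕ.* e)
  x[y*y]≡[z*z][z*z]⇒x^e*y^[2e]≡z^[4e] {x} {y} {z} x[y*y]≡z⁴ e = begin
    x ^ e * y ^ (2 ℕ.* e)      ≡⟨ cong (_*_ (x ^ e)) ([x*x]^e≡x^[2*e] y e) ⟨
    x ^ e * (y * y) ^ e        ≡⟨ ^-distribʳ-* x (y * y) e ⟨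
    (x * (y * y)) ^ e          ≡⟨ cong (_^ e) x[y*y]≡z⁴ ⟩
    ((z * z) * (z * z)) ^ e    ≡⟨ [x*x]^e≡x^[2*e] (z * z) e ⟩
    (z * z) ^ (2 ℕ.* e)        ≡⟨ [x*x]^e≡x^[2*e] z (2 ℕ.* e) ⟩
    z ^ (2 ℕ.* (2 ℕ.* e))      ≡⟨ cong (z ^_) (ℕ.*-assoc 2 2 e) ⟨
    z ^ (4 ℕ.* e)              ∎
    where open ≡-Reasoning

  -1^[2*j]≡1 : ∀ j → (- 1#) ^ (2 ℕ.* j) ≡ 1#
  -1^[2*j]≡1 j = begin
    (- 1#) ^ (2 ℕ.* j)     ≡⟨ ^-*-assoc (- 1#) 2 j ⟨
    ((- 1#) ^ 2) ^ j       ≡⟨ cong (_^ j) (solve 0 (:- :1 :* (:- :1 :* :1) := :1) refl) ⟩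
    1# ^ j                 ≡⟨ ^-zeroˡ j ⟩
    1#                     ∎
    where open ≡-Reasoning

module FieldHomProperties {K L : Field} (h : FieldHom K L) where
  private
    module K = FieldProperties K
    module L = FieldProperties L
  open FieldHom h public

  ι-0 : ι K.0# ≡ L.0#
  ι-0 = L.linear-combination L.1#
    (L.solve 1 (λ x → x L.:= L.:0 L.:+ L.:1 L.:* ((x L.:+ x) L.:- x)) refl (ι K.0#))
    (trans (sym (ι-+ K.0# K.0#)) (cong ι (K.+-identityˡ K.0#)))

  ι-neg : ∀ x → ι (K.- x) ≡ L.- ι x
  ι-neg x = L.linear-combination L.1#
    (L.solve 2 (λ y x → y L.:= L.:- x L.:+ L.:1 L.:* ((y L.:+ x) L.:- L.:0)) refl (ι (K.- x)) (ι x))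
    (trans (sym (ι-+ (K.- x) x)) (trans (cong ι (K.-‿inverseˡ x)) ι-0))

  ι-injective : ∀ {x y} → ι x ≡ ι y → x ≡ y
  ι-injective {x} {y} ιx≡ιy with x K.- y K.≟ K.0#
  ... | yes x-y≡0 = K.linear-combination K.1#
          (K.solve 2 (λ x y → x K.:= y K.:+ K.:1 K.:* ((x K.:- y) K.:- K.:0)) refl x y) x-y≡0
  ... | no  x-y≢0 = ⊥-elim (L.0≢1 (begin
      L.0#                                   ≡⟨ L.zeroˡ _ ⟨
      L.0# L.* ι ((x K.- y) K.⁻¹)            ≡⟨ cong (L._* ι ((x K.- y) K.⁻¹)) ι[x-y]≡0 ⟨
      ι (x K.- y) L.* ι ((x K.- y) K.⁻¹)     ≡⟨ ι-* _ _ ⟨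
      ι ((x K.- y) K.* (x K.- y) K.⁻¹)       ≡⟨ cong ι (K.⁻¹-inverse _ x-y≢0) ⟩
      ι K.1#                                 ≡⟨ ι-1 ⟩
      L.1#                                   ∎))
    where
    open ≡-Reasoning
    ι[x-y]≡0 : ι (x K.- y) ≡ L.0#
    ι[x-y]≡0 = trans (ι-+ x (K.- y)) (trans (cong (ι x L.+_) (ι-neg y)) (trans (cong (L._- ι y) ιx≡ιy) (L.-‿inverseʳ (ι y))))

  ι-≢0 : ∀ {x} → x ≢ K.0# → ι x ≢ L.0#
  ι-≢0 x≢0 ιx≡0 = x≢0 (ι-injective (trans ιx≡0 (sym ι-0)))

  ι-^ : ∀ x n → ι (x K.^ n) ≡ ι x L.^ n
  ι-^ x zero    = ι-1
  ι-^ x (suc n) = trans (ι-* x (x K.^ n)) (cong (ι x L.*_) (ι-^ x n))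

  ι-fromℕ : ∀ n → ι (K.fromℕ n) ≡ L.fromℕ n
  ι-fromℕ zero    = ι-0
  ι-fromℕ (suc n) = trans (ι-+ _ _) (cong₂ L._+_ ι-1 (ι-fromℕ n))

  ι-fromℤ : ∀ i → ι (K.fromℤ i) ≡ L.fromℤ i
  ι-fromℤ (+ n)    = ι-fromℕ n
  ι-fromℤ -[1+ n ] = trans (ι-neg _) (cong L.-_ (ι-fromℕ (suc n)))

-- Products over duplicate-free lists

module Removal {A : Set} (_≟_ : DecidableEquality A) where

  remove : A → List A → List A
  remove x []       = []
  remove x (y ∷ ys) with y ≟ x
  ... | yes _ = ys
  ... | no  _ = y ∷ remove x ys

  head∉tail : ∀ {x : A} {xs} → Unique (x ∷ xs) → x ∉ xs
  head∉tail (x≢xs ∷ _) = All¬⇒¬Any x≢xs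

  ∈-remove⁻ : ∀ {x y} ys → y ∈ remove x ys → y ∈ ys
  ∈-remove⁻ {x} (z ∷ ys) y∈ with z ≟ x
  ∈-remove⁻ (z ∷ ys) y∈          | yes _ = there y∈
  ∈-remove⁻ (z ∷ ys) (here y≡z)  | no  _ = here y≡z
  ∈-remove⁻ (z ∷ ys) (there y∈)  | no  _ = there (∈-remove⁻ ys y∈)

  ∈-remove⁺ : ∀ {x y} ys → y ∈ ys → y ≢ x → y ∈ remove x ys
  ∈-remove⁺ {x} (z ∷ ys) y∈ y≢x with z ≟ x
  ∈-remove⁺ (z ∷ ys) (here refl) y≢x | yes z≡x = ⊥-elim (y≢x z≡x)
  ∈-remove⁺ (z ∷ ys) (there y∈)  y≢x | yes _   = y∈
  ∈-remove⁺ (z ∷ ys) (here y≡z)  y≢x | no  _   = here y≡z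
  ∈-remove⁺ (z ∷ ys) (there y∈)  y≢x | no  _   = there (∈-remove⁺ ys y∈ y≢x)

  ∉-remove : ∀ {x} ys → Unique ys → x ∉ remove x ys
  ∉-remove {x} (z ∷ ys) u x∈ with z ≟ x
  ∉-remove (z ∷ ys) u         x∈          | yes refl = head∉tail u x∈
  ∉-remove (z ∷ ys) u         (here refl) | no  z≢x  = z≢x refl
  ∉-remove (z ∷ ys) (_ ∷ u)   (there x∈)  | no  _    = ∉-remove ys u x∈

  Unique-remove : ∀ {x} ys → Unique ys → Unique (remove x ys)
  Unique-remove         []       u = u
  Unique-remove {x} (z ∷ ys) u with z ≟ x
  Unique-remove (z ∷ ys) (_ ∷ u) | yes _ = u
  Unique-remove (z ∷ ys) u       | no  _ =
    ¬Any⇒All¬ _ (λ z∈ → head∉tail u (∈-remove⁻ ys z∈)) ∷ Unique-remove ys (tail u)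
    where
    tail : ∀ {y : A} {ys} → Unique (y ∷ ys) → Unique ys
    tail (_ ∷ u) = u

  length-remove : ∀ {x} ys → x ∈ ys → length ys ≡ suc (length (remove x ys))
  length-remove {x} (z ∷ ys) x∈ with z ≟ x
  length-remove (z ∷ ys) x∈          | yes _   = refl
  length-remove (z ∷ ys) (here x≡z)  | no  z≢x = ⊥-elim (z≢x (sym x≡z))
  length-remove (z ∷ ys) (there x∈)  | no  _   = cong suc (length-remove ys x∈)

module CommutativeMonoidFolds {M : Set} (_≟_ : DecidableEquality M) {_∙_ : M → M → M} {ε : M}
                              (isCommutativeMonoid : IsCommutativeMonoid _≡_ _∙_ ε) where
  open IsCommutativeMonoid isCommutativeMonoid using (assoc; comm)
  open Removal _≟_

  fold : List M → M
  fold = foldr _∙_ ε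

  _^_ : M → ℕ → M
  x ^ zero  = ε
  x ^ suc n = x ∙ (x ^ n)

  fold-remove : ∀ {x} ys → x ∈ ys → fold ys ≡ x ∙ fold (remove x ys)
  fold-remove {x} (z ∷ ys) x∈ with z ≟ x
  fold-remove (z ∷ ys) x∈         | yes refl = refl
  fold-remove (z ∷ ys) (here x≡z) | no  z≢x  = ⊥-elim (z≢x (sym x≡z))
  fold-remove {x} (z ∷ ys) (there x∈) | no _ = begin
    z ∙ fold ys                     ≡⟨ cong (_∙_ z) (fold-remove ys x∈) ⟩
    z ∙ (x ∙ fold (remove x ys))    ≡⟨ assoc _ _ _ ⟨
    (z ∙ x) ∙ fold (remove x ys)    ≡⟨ cong (_∙ fold (remove x ys)) (comm z x) ⟩
    (x ∙ z) ∙ fold (remove x ys)    ≡⟨ assoc _ _ _ ⟩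
    x ∙ (z ∙ fold (remove x ys))    ∎
    where open ≡-Reasoning

  fold-sameElements : ∀ xs ys → Unique xs → Unique ys →
    (∀ {z} → z ∈ xs → z ∈ ys) → (∀ {z} → z ∈ ys → z ∈ xs) → fold xs ≡ fold ys
  fold-sameElements []       []       _ _ _ _ = refl
  fold-sameElements []       (y ∷ ys) _ _ _ ys⊆xs with ys⊆xs (here refl)
  ... | ()
  fold-sameElements (x ∷ xs) ys (x∉xs ∷ uxs) uys xs⊆ys ys⊆xs = begin
    x ∙ fold xs                ≡⟨ cong (_∙_ x) (fold-sameElements xs (remove x ys) uxs (Unique-remove ys uys) ⊆ ⊇) ⟩
    x ∙ fold (remove x ys)     ≡⟨ fold-remove ys (xs⊆ys (here refl)) ⟨
    fold ys                    ∎
    where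
    open ≡-Reasoning
    ⊆ : ∀ {z} → z ∈ xs → z ∈ remove x ys
    ⊆ z∈ = ∈-remove⁺ ys (xs⊆ys (there z∈)) λ { refl → All¬⇒¬Any x∉xs z∈ }
    ⊇ : ∀ {z} → z ∈ remove x ys → z ∈ xs
    ⊇ z∈ with ys⊆xs (∈-remove⁻ ys z∈)
    ... | here refl = ⊥-elim (∉-remove ys uys z∈)
    ... | there z∈xs = z∈xs

  fold-involution : ∀ (σ : M → M) a xs → Unique xs →
    (∀ {x} → x ∈ xs → σ x ∈ xs) → (∀ {x} → x ∈ xs → σ (σ x) ≡ x) →
    (∀ {x} → x ∈ xs → σ x ≢ x) → (∀ {x} → x ∈ xs → x ∙ σ x ≡ a) →
    Σ ℕ λ k → length xs ≡ 2 ℕ.* k × fold xs ≡ a ^ k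
  fold-involution σ a xs = pairs (length xs) xs refl
    where
    -- Recursion on the length n: remove (σ x) ys is not a structural subterm of x ∷ ys.
    pairs : ∀ n xs → length xs ≡ n → Unique xs →
      (∀ {x} → x ∈ xs → σ x ∈ xs) → (∀ {x} → x ∈ xs → σ (σ x) ≡ x) →
      (∀ {x} → x ∈ xs → σ x ≢ x) → (∀ {x} → x ∈ xs → x ∙ σ x ≡ a) →
      Σ ℕ λ k → length xs ≡ 2 ℕ.* k × fold xs ≡ a ^ k
    pairs zero          []       _ _ _ _ _ _ = 0 , refl , refl
    pairs (suc zero)    (x ∷ []) _ _ closed _ fixFree _ with closed (here refl)
    ... | here σx≡x = ⊥-elim (fixFree (here refl) σx≡x)
    pairs (suc (suc n)) (x ∷ ys) len (x∉ys ∷ uys) closed involutive fixFree paired =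
      suc k , length≡ , fold≡
      where
      σx∈ys : σ x ∈ ys
      σx∈ys with closed (here refl)
      ... | here σx≡x = ⊥-elim (fixFree (here refl) σx≡x)
      ... | there σx∈ = σx∈

      zs : List M
      zs = remove (σ x) ys

      inner : ∀ {y} → y ∈ zs → y ∈ x ∷ ys
      inner y∈ = there (∈-remove⁻ ys y∈)

      closed′ : ∀ {y} → y ∈ zs → σ y ∈ zs
      closed′ {y} y∈ with closed (inner y∈)
      ... | here σy≡x = ⊥-elim (∉-remove ys uys (subst (_∈ zs) y≡σx y∈))
        where
        y≡σx : y ≡ σ x
        y≡σx = trans (sym (involutive (inner y∈))) (cong σ σy≡x)
      ... | there σy∈ = ∈-remove⁺ ys σy∈ λ σy≡σx →
        All¬⇒¬Any x∉ys (subst (_∈ ys) (trans (sym (involutive (inner y∈)))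
          (trans (cong σ σy≡σx) (involutive (here refl)))) (∈-remove⁻ ys y∈))

      length-zs : length zs ≡ n
      length-zs = ℕ.suc-injective (trans (sym (length-remove ys σx∈ys)) (ℕ.suc-injective len))

      rest : Σ ℕ λ k → length zs ≡ 2 ℕ.* k × fold zs ≡ a ^ k
      rest = pairs n zs length-zs (Unique-remove ys uys) closed′
        (λ y∈ → involutive (inner y∈)) (λ y∈ → fixFree (inner y∈)) (λ y∈ → paired (inner y∈))

      k : ℕ
      k = proj₁ rest

      length≡ : suc (length ys) ≡ 2 ℕ.* suc k
      length≡ = begin
        suc (length ys)           ≡⟨ cong suc (length-remove ys σx∈ys) ⟩
        suc (suc (length zs))     ≡⟨ cong (λ l → suc (suc l)) (proj₁ (proj₂ rest)) ⟩
        suc (suc (2 ℕ.* k))       ≡⟨ ℕ.*-suc 2 k ⟨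
        2 ℕ.* suc k               ∎
        where open ≡-Reasoning

      fold≡ : x ∙ fold ys ≡ a ^ suc k
      fold≡ = begin
        x ∙ fold ys               ≡⟨ cong (_∙_ x) (fold-remove ys σx∈ys) ⟩
        x ∙ (σ x ∙ fold zs)       ≡⟨ assoc _ _ _ ⟨
        (x ∙ σ x) ∙ fold zs       ≡⟨ cong₂ _∙_ (paired (here refl)) (proj₂ (proj₂ rest)) ⟩
        a ∙ (a ^ k)               ∎
        where open ≡-Reasoning

-- The binomial theorem in characteristic p

module Frobenius (L : Field) where
  open FieldProperties L
  private
    open Binomial (CommutativeRing.commutativeSemiring commutativeRing)
      using (theorem; binomialTerm)
    module R = RawSemiringDefinitions (Semiring.rawSemiring (CommutativeRing.semiring commutativeRing))

    R^≡^ : ∀ x n → x R.^ n ≡ x ^ n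
    R^≡^ x zero    = refl
    R^≡^ x (suc n) = cong (_*_ x) (R^≡^ x n)

    ×≡fromℕ* : ∀ n x → n R.× x ≡ fromℕ n * x
    ×≡fromℕ* zero    x = sym (zeroˡ x)
    ×≡fromℕ* (suc n) x = trans (cong (_+_ x) (×≡fromℕ* n x))
      (solve 2 (λ x m → x :+ m :* x := (:1 :+ m) :* x) refl x (fromℕ n))

    sum-last : ∀ n (t : Fin (suc n) → Carrier) → (∀ i → t (inject₁ i) ≡ 0#) → R.sum t ≡ t (Fin.fromℕ n)
    sum-last zero    t _         = +-identityʳ _
    sum-last (suc n) t t[i]≡0 = begin
      t Fin.zero + R.sum (λ i → t (Fin.suc i))   ≡⟨ cong (_+ R.sum (λ i → t (Fin.suc i))) (t[i]≡0 Fin.zero) ⟩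
      0# + R.sum (λ i → t (Fin.suc i))           ≡⟨ +-identityˡ _ ⟩
      R.sum (λ i → t (Fin.suc i))                ≡⟨ sum-last n (λ i → t (Fin.suc i)) (λ i → t[i]≡0 (Fin.suc i)) ⟩
      t (Fin.fromℕ (suc n))                      ∎
      where open ≡-Reasoning

  ^-distrib-+-if-binomials-vanish : ∀ n → fromℕ (suc n) ≡ 0# →
    (∀ {j} → 1 ℕ.≤ j → j ℕ.< suc n → suc n ∣ (suc n C j)) →
    ∀ x y → (x + y) ^ suc n ≡ x ^ suc n + y ^ suc n
  ^-distrib-+-if-binomials-vanish n char≡0 divides-binomial x y = begin
    (x + y) ^ P                                                   ≡⟨ R^≡^ (x + y) P ⟨
    (x + y) R.^ P                                                 ≡⟨ theorem P x y ⟩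
    term Fin.zero + R.sum (λ i → term (Fin.suc i))                ≡⟨ cong (_+_ (term Fin.zero)) middle-sum ⟩
    term Fin.zero + term (Fin.fromℕ P)                            ≡⟨ cong₂ _+_ first last ⟩
    y ^ P + x ^ P                                                 ≡⟨ +-comm _ _ ⟩
    x ^ P + y ^ P                                                 ∎
    where
    open ≡-Reasoning
    P : ℕ
    P = suc n

    term : Fin (suc P) → Carrier
    term = binomialTerm x y P

    first : term Fin.zero ≡ y ^ P
    first = trans (×≡fromℕ* 1 _) (trans (cong₂ _*_ (+-identityʳ 1#) (trans (*-identityˡ _) (R^≡^ y P))) (*-identityˡ _))

    last : term (Fin.fromℕ P) ≡ x ^ P
    last = begin
      term (Fin.fromℕ P)                       ≡⟨ cong (λ j → (P C j) R.× (x R.^ j * y R.^ (P ℕ.∸ j))) (toℕ-fromℕ P) ⟩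
      (P C P) R.× (x R.^ P * y R.^ (P ℕ.∸ P))  ≡⟨ cong₂ (λ c k → c R.× (x R.^ P * y R.^ k)) (nCn≡1 P) (ℕ.n∸n≡0 P) ⟩
      1 R.× (x R.^ P * 1#)                     ≡⟨ ×≡fromℕ* 1 _ ⟩
      (1# + 0#) * (x R.^ P * 1#)               ≡⟨ cong₂ _*_ (+-identityʳ 1#) (trans (*-identityʳ _) (R^≡^ x P)) ⟩
      1# * x ^ P                               ≡⟨ *-identityˡ _ ⟩
      x ^ P                                    ∎

    middle≡0 : ∀ i → term (Fin.suc (inject₁ i)) ≡ 0#
    middle≡0 i with divides-binomial {suc (toℕ (inject₁ i))} (ℕ.s≤s ℕ.z≤n)
                      (ℕ.s≤s (subst (ℕ._< n) (sym (toℕ-inject₁ i)) (toℕ<n i)))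
    ... | divides d PCj≡d*P = begin
      (P C j) R.× t            ≡⟨ ×≡fromℕ* (P C j) t ⟩
      fromℕ (P C j) * t        ≡⟨ cong (λ c → fromℕ c * t) PCj≡d*P ⟩
      fromℕ (d ℕ.* P) * t      ≡⟨ cong (_* t) (fromℕ-* d P) ⟩
      fromℕ d * fromℕ P * t    ≡⟨ cong (λ c → fromℕ d * c * t) char≡0 ⟩
      fromℕ d * 0# * t         ≡⟨ solve 2 (λ d t → d :* :0 :* t := :0) refl (fromℕ d) t ⟩
      0#                       ∎
      where
      j : ℕ
      j = suc (toℕ (inject₁ i))

      t : Carrier
      t = x R.^ j * y R.^ (P ℕ.∸ j)

    middle-sum : R.sum (λ i → term (Fin.suc i)) ≡ term (Fin.fromℕ P)
    middle-sum = sum-last n (λ i → term (Fin.suc i)) middle≡0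

  freshman's-dream : ∀ {p} → Prime p → fromℕ p ≡ 0# → ∀ x y → (x + y) ^ p ≡ x ^ p + y ^ p
  freshman's-dream {zero}  p-prime _ with ℕ.nonTrivial⇒n>1 0 {{prime⇒nonTrivial p-prime}}
  ... | ()
  freshman's-dream {suc n} p-prime char≡p = ^-distrib-+-if-binomials-vanish n char≡p (prime∣pCj p-prime)

  frobenius-+ : ∀ {p} → Prime p → fromℕ p ≡ 0# → ∀ k x y → (x + y) ^ (p ℕ.^ k) ≡ x ^ (p ℕ.^ k) + y ^ (p ℕ.^ k)
  frobenius-+ p-prime char≡p zero    x y = trans (*-identityʳ _) (cong₂ _+_ (sym (*-identityʳ x)) (sym (*-identityʳ y)))
  frobenius-+ {p} p-prime char≡p (suc k) x y = begin
    (x + y) ^ (p ℕ.* p ℕ.^ k)                      ≡⟨ ^-*-assoc (x + y) p (p ℕ.^ k) ⟨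
    ((x + y) ^ p) ^ (p ℕ.^ k)                      ≡⟨ cong (_^ (p ℕ.^ k)) (freshman's-dream p-prime char≡p x y) ⟩
    (x ^ p + y ^ p) ^ (p ℕ.^ k)                    ≡⟨ frobenius-+ p-prime char≡p k _ _ ⟩
    (x ^ p) ^ (p ℕ.^ k) + (y ^ p) ^ (p ℕ.^ k)      ≡⟨ cong₂ _+_ (^-*-assoc x p (p ℕ.^ k)) (^-*-assoc y p (p ℕ.^ k)) ⟩
    x ^ (p ℕ.* p ℕ.^ k) + y ^ (p ℕ.* p ℕ.^ k)      ∎
    where open ≡-Reasoning

-- The unit circle a² + b² = 1

module UnitCircle (K : Field) where
  open FieldProperties K

  module Point {a b : Carrier} (circle : a * a + b * b ≡ 1#) where

    [1-a][1+a]≡b² : (1# - a) * (1# + a) ≡ b * b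
    [1-a][1+a]≡b² = linear-combination (- 1#)
      (solve 2 (λ a b → (:1 :- a) :* (:1 :+ a) := b :* b :+ :- :1 :* (a :* a :+ b :* b :- :1)) refl a b) circle

    [1-b][1+b]≡a² : (1# - b) * (1# + b) ≡ a * a
    [1-b][1+b]≡a² = linear-combination (- 1#)
      (solve 2 (λ a b → (:1 :- b) :* (:1 :+ b) := a :* a :+ :- :1 :* (a :* a :+ b :* b :- :1)) refl a b) circle

    [1+a][2[1+b]]≡[1+a+b]² : (1# + a) * ((1# + 1#) * (1# + b)) ≡ (1# + a + b) * (1# + a + b)
    [1+a][2[1+b]]≡[1+a+b]² = linear-combination (- 1#)
      (solve 2 (λ a b → (:1 :+ a) :* (:2 :* (:1 :+ b)) := (:1 :+ a :+ b) :* (:1 :+ a :+ b) :+ :- :1 :* (a :* a :+ b :* b :- :1))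
        refl a b) circle

    2[a²-b²]+2≡[2a]² : (1# + 1#) * (a * a - b * b) + (1# + 1#) ≡ ((1# + 1#) * a) * ((1# + 1#) * a)
    2[a²-b²]+2≡[2a]² = linear-combination (- (1# + 1#))
      (solve 2 (λ a b → :2 :* (a :* a :- b :* b) :+ :2 := (:2 :* a) :* (:2 :* a) :+ :- :2 :* (a :* a :+ b :* b :- :1))
        refl a b) circle

    2-2[a²-b²]≡[2b]² : (1# + 1#) - (1# + 1#) * (a * a - b * b) ≡ ((1# + 1#) * b) * ((1# + 1#) * b)
    2-2[a²-b²]≡[2b]² = linear-combination (- (1# + 1#))
      (solve 2 (λ a b → :2 :- :2 :* (a :* a :- b :* b) := (:2 :* b) :* (:2 :* b) :+ :- :2 :* (a :* a :+ b :* b :- :1))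
        refl a b) circle

    module SquareRoot {u} (u≢0 : u ≢ 0#) (u+u⁻¹≡ : u + u ⁻¹ ≡ (1# + 1#) * (a * a - b * b))
                      (2ab≢0 : (1# + 1#) * a * b ≢ 0#) where
      private
        d n : Carrier
        d = (1# + 1#) * a * b
        n = u - (a * a - b * b)

      i : Carrier
      i = n * d ⁻¹

      private
        u²≡ru-1 : u * u ≡ (1# + 1#) * (a * a - b * b) * u - 1#
        u²≡ru-1 = linear-combination₂ u (- 1#)
          (solve 4 (λ u u' a b → u :* u := :2 :* (a :* a :- b :* b) :* u :- :1
                      :+ u :* (u :+ u' :- :2 :* (a :* a :- b :* b)) :+ :- :1 :* (u :* u' :- :1)) refl u (u ⁻¹) a b)
          u+u⁻¹≡ (⁻¹-inverse u u≢0)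

        n²≡-d² : n * n ≡ - (d * d)
        n²≡-d² = linear-combination₂ 1# (a * a + b * b + 1#)
          (solve 3 (λ u a b → (u :- (a :* a :- b :* b)) :* (u :- (a :* a :- b :* b))
                      := :- (:2 :* a :* b :* (:2 :* a :* b))
                      :+ :1 :* (u :* u :- (:2 :* (a :* a :- b :* b) :* u :- :1))
                      :+ (a :* a :+ b :* b :+ :1) :* (a :* a :+ b :* b :- :1)) refl u a b)
          u²≡ru-1 circle

      i*i≡-1 : i * i ≡ - 1#
      i*i≡-1 = linear-combination₂ (d ⁻¹ * d ⁻¹) (- (d * d ⁻¹ + 1#))
        (solve 3 (λ n d d' → n :* d' :* (n :* d') := :- :1 :+ d' :* d' :* (n :* n :- :- (d :* d))
                    :+ :- (d :* d' :+ :1) :* (d :* d' :- :1)) refl n d (d ⁻¹))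
        n²≡-d² (⁻¹-inverse d 2ab≢0)

      [a+bi]²≡u : (a + b * i) * (a + b * i) ≡ u
      [a+bi]²≡u = linear-combination₂ (b * b) n
        (solve 4 (λ u a b d' → (a :+ b :* ((u :- (a :* a :- b :* b)) :* d')) :* (a :+ b :* ((u :- (a :* a :- b :* b)) :* d'))
                    := u :+ b :* b :* ((u :- (a :* a :- b :* b)) :* d' :* ((u :- (a :* a :- b :* b)) :* d') :- :- :1)
                    :+ (u :- (a :* a :- b :* b)) :* (:2 :* a :* b :* d' :- :1)) refl u a b (d ⁻¹))
        i*i≡-1 (⁻¹-inverse d 2ab≢0)

    module GaussianSquare {i} (i*i≡-1 : i * i ≡ - 1#) where
      [X+Yi]²≡4[1+b][a+bi] : ((1# + a + b) + (1# - a + b) * i) * ((1# + a + b) + (1# - a + b) * i)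
                             ≡ (1# + 1#) * (1# + 1#) * (1# + b) * (a + b * i)
      [X+Yi]²≡4[1+b][a+bi] = linear-combination₂ ((1# - a + b) * (1# - a + b)) (- ((1# + 1#) * i))
        (solve 3 (λ a b i → ((:1 :+ a :+ b) :+ (:1 :- a :+ b) :* i) :* ((:1 :+ a :+ b) :+ (:1 :- a :+ b) :* i)
                    := :2 :* :2 :* (:1 :+ b) :* (a :+ b :* i)
                    :+ (:1 :- a :+ b) :* (:1 :- a :+ b) :* (i :* i :- :- :1)
                    :+ :- (:2 :* i) :* (a :* a :+ b :* b :- :1)) refl a b i)
        i*i≡-1 circle

      [X+Yi][X-Yi]≡4[1+b] : ((1# + a + b) + (1# - a + b) * i) * ((1# + a + b) + (1# - a + b) * - i)
                            ≡ (1# + 1#) * (1# + 1#) * (1# + b)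
      [X+Yi][X-Yi]≡4[1+b] = linear-combination₂ (- ((1# - a + b) * (1# - a + b))) (1# + 1#)
        (solve 3 (λ a b i → ((:1 :+ a :+ b) :+ (:1 :- a :+ b) :* i) :* ((:1 :+ a :+ b) :+ (:1 :- a :+ b) :* :- i)
                    := :2 :* :2 :* (:1 :+ b)
                    :+ :- ((:1 :- a :+ b) :* (:1 :- a :+ b)) :* (i :* i :- :- :1)
                    :+ :2 :* (a :* a :+ b :* b :- :1)) refl a b i)
        i*i≡-1 circle

module TauParametrisation (K : Field) where
  open FieldProperties K

  module Roots {τ c c′ : Carrier} (τ≢0 : τ ≢ 0#) (1+τ≢0 : 1# + τ ≢ 0#)
               (c*c≡1+τ : c * c ≡ 1# + τ) (c′*c′≡1+τ⁻¹ : c′ * c′ ≡ 1# + τ ⁻¹) where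

    c≢0 : c ≢ 0#
    c≢0 c≡0 = 1+τ≢0 (trans (sym c*c≡1+τ) (trans (cong (_* c) c≡0) (zeroˡ c)))

    c′≢0 : c′ ≢ 0#
    c′≢0 c′≡0 = 1+τ≢0 (begin
      1# + τ             ≡⟨ linear-combination (- 1#)
                              (solve 2 (λ τ τ' → :1 :+ τ := τ :* (:1 :+ τ') :+ :- :1 :* (τ :* τ' :- :1)) refl τ (τ ⁻¹))
                              (⁻¹-inverse τ τ≢0) ⟩
      τ * (1# + τ ⁻¹)    ≡⟨ cong (_*_ τ) c′*c′≡1+τ⁻¹ ⟨
      τ * (c′ * c′)      ≡⟨ cong (λ x → τ * (x * x)) c′≡0 ⟩
      τ * (0# * 0#)      ≡⟨ solve 1 (λ τ → τ :* (:0 :* :0) := :0) refl τ ⟩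
      0#                 ∎)
      where open ≡-Reasoning

    private
      1+τ⁻¹≢0 : 1# + τ ⁻¹ ≢ 0#
      1+τ⁻¹≢0 1+τ⁻¹≡0 = x*y≢0 c′≢0 c′≢0 (trans c′*c′≡1+τ⁻¹ 1+τ⁻¹≡0)

      c⁻¹²≡[1+τ]⁻¹ : c ⁻¹ * c ⁻¹ ≡ (1# + τ) ⁻¹
      c⁻¹²≡[1+τ]⁻¹ = trans (sym (⁻¹-distrib-* c≢0 c≢0)) (cong _⁻¹ c*c≡1+τ)

      c′⁻¹²≡[1+τ⁻¹]⁻¹ : c′ ⁻¹ * c′ ⁻¹ ≡ (1# + τ ⁻¹) ⁻¹
      c′⁻¹²≡[1+τ⁻¹]⁻¹ = trans (sym (⁻¹-distrib-* c′≢0 c′≢0)) (cong _⁻¹ c′*c′≡1+τ⁻¹)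

    circle : c ⁻¹ * c ⁻¹ + c′ ⁻¹ * c′ ⁻¹ ≡ 1#
    circle = begin
      c ⁻¹ * c ⁻¹ + c′ ⁻¹ * c′ ⁻¹          ≡⟨ cong₂ _+_ c⁻¹²≡[1+τ]⁻¹ c′⁻¹²≡[1+τ⁻¹]⁻¹ ⟩
      (1# + τ) ⁻¹ + (1# + τ ⁻¹) ⁻¹          ≡⟨ x+y≡x*y⇒x⁻¹+y⁻¹≡1 1+τ≢0 1+τ⁻¹≢0 [1+τ]+[1+τ⁻¹]≡[1+τ][1+τ⁻¹] ⟩
      1#                                   ∎
      where
      open ≡-Reasoning
      [1+τ]+[1+τ⁻¹]≡[1+τ][1+τ⁻¹] : (1# + τ) + (1# + τ ⁻¹) ≡ (1# + τ) * (1# + τ ⁻¹)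
      [1+τ]+[1+τ⁻¹]≡[1+τ][1+τ⁻¹] = linear-combination (- 1#)
        (solve 2 (λ τ τ' → (:1 :+ τ) :+ (:1 :+ τ') := (:1 :+ τ) :* (:1 :+ τ') :+ :- :1 :* (τ :* τ' :- :1)) refl τ (τ ⁻¹))
        (⁻¹-inverse τ τ≢0)

    r≡2[c⁻²-c′⁻²] : (1# + 1#) * (1# - τ) * (1# + τ) ⁻¹ ≡ (1# + 1#) * (c ⁻¹ * c ⁻¹ - c′ ⁻¹ * c′ ⁻¹)
    r≡2[c⁻²-c′⁻²] = linear-combination₃ (- (1# + 1#)) (- ((1# + 1#) * (1# + 1#))) (1# + 1#)
      (solve 4 (λ τ x' a b → :2 :* (:1 :- τ) :* x' := :2 :* (a :* a :- b :* b)
                  :+ :- :2 :* ((:1 :+ τ) :* x' :- :1) :+ :- (:2 :* :2) :* (a :* a :- x') :+ :2 :* (a :* a :+ b :* b :- :1))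
        refl τ ((1# + τ) ⁻¹) (c ⁻¹) (c′ ⁻¹))
      (⁻¹-inverse (1# + τ) 1+τ≢0) c⁻¹²≡[1+τ]⁻¹ circle

-- Finite fields

module FiniteFieldTheory {q} (F : FiniteField q) {p k} (p-prime : Prime p) (p≢2 : p ≢ 2) (q≡p^k : q ≡ p ℕ.^ k) where
  open FieldProperties (FiniteField.field′ F) public
  open FiniteField F public using (legendre)
  open FiniteField F using (enum; isSquare?; 𝒜)
  private
    open S.IsCommutativeRing isCommutativeRing using (+-isCommutativeMonoid; *-isCommutativeMonoid)
    module Sum     = CommutativeMonoidFolds _≟_ +-isCommutativeMonoid
    module Product = CommutativeMonoidFolds _≟_ *-isCommutativeMonoid
    open Removal _≟_

    to : Fin q → Carrier
    to = Inverse.to enum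

    to-from : ∀ x → to (Inverse.from enum x) ≡ x
    to-from = Inverse.strictlyInverseˡ enum

  elements : List Carrier
  elements = map to (allFin q)

  Unique-elements : Unique elements
  Unique-elements = map⁺ to-injective (allFin⁺ q)
    where
    to-injective : ∀ {i j} → to i ≡ to j → i ≡ j
    to-injective {i} {j} e = trans (sym (Inverse.strictlyInverseʳ enum i))
      (trans (cong (Inverse.from enum) e) (Inverse.strictlyInverseʳ enum j))

  ∈-elements : ∀ x → x ∈ elements
  ∈-elements x = subst (_∈ elements) (to-from x) (∈-map⁺ to (∈-allFin _))

  length-elements : length elements ≡ q
  length-elements = trans (length-map to (allFin q)) (length-tabulate (λ i → i))

  -- Adding 1 permutes the field, so the sum T of all elements satisfies q·1 + T = T.
  fromℕq≡0 : fromℕ q ≡ 0#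
  fromℕq≡0 = linear-combination 1#
    (solve 2 (λ n t → n := :0 :+ :1 :* ((n :+ t) :- t)) refl (fromℕ q) T) q+T≡T
    where
    open ≡-Reasoning
    T : Carrier
    T = Sum.fold elements

    shifted : List Carrier
    shifted = map (_+_ 1#) elements

    sum-shift : ∀ xs → Sum.fold (map (_+_ 1#) xs) ≡ fromℕ (length xs) + Sum.fold xs
    sum-shift []       = sym (+-identityˡ 0#)
    sum-shift (x ∷ xs) = trans (cong (_+_ (1# + x)) (sum-shift xs))
      (solve 3 (λ x n t → (:1 :+ x) :+ (n :+ t) := (:1 :+ n) :+ (x :+ t)) refl x (fromℕ (length xs)) (Sum.fold xs))

    1+-injective : ∀ {x y} → 1# + x ≡ 1# + y → x ≡ y
    1+-injective {x} {y} e = linear-combination 1#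
      (solve 2 (λ x y → x := y :+ :1 :* ((:1 :+ x) :- (:1 :+ y))) refl x y) e

    ∈-shifted : ∀ {z} → z ∈ shifted
    ∈-shifted {z} = subst (_∈ shifted) (solve 1 (λ z → :1 :+ (z :+ :- :1) := z) refl z)
      (∈-map⁺ (_+_ 1#) (∈-elements (z + - 1#)))

    q+T≡T : fromℕ q + T ≡ T
    q+T≡T = begin
      fromℕ q + T                 ≡⟨ cong (λ n → fromℕ n + T) length-elements ⟨
      fromℕ (length elements) + T ≡⟨ sum-shift elements ⟨
      Sum.fold shifted            ≡⟨ Sum.fold-sameElements shifted elements (map⁺ 1+-injective Unique-elements)
                                       Unique-elements (λ {z} _ → ∈-elements z) (λ _ → ∈-shifted) ⟩
      T                           ∎

  fromℕp≡0 : fromℕ p ≡ 0#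
  fromℕp≡0 with fromℕ p ≟ 0#
  ... | yes p≡0 = p≡0
  ... | no  p≢0 = ⊥-elim (x^n≢0 k p≢0 (begin
    fromℕ p ^ k      ≡⟨ fromℕ-^ p k ⟨
    fromℕ (p ℕ.^ k)  ≡⟨ cong fromℕ q≡p^k ⟨
    fromℕ q          ≡⟨ fromℕq≡0 ⟩
    0#               ∎))
    where open ≡-Reasoning

  two≢0 : 1# + 1# ≢ 0#
  two≢0 2≡0 with ¬2∣n⇒odd (odd-prime∤2 p-prime p≢2)
  ... | h , p≡1+2h = 1≢0 (begin
    1#                                    ≡⟨ linear-combination (- fromℕ h)
                                               (solve 1 (λ h → :1 := (:1 :+ (:1 :+ (:1 :+ :0)) :* h) :+ :- h :* (:2 :- :0)) refl (fromℕ h))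
                                               2≡0 ⟩
    1# + fromℕ 2 * fromℕ h                ≡⟨ cong (_+_ 1#) (fromℕ-* 2 h) ⟨
    fromℕ (suc (2 ℕ.* h))                 ≡⟨ cong fromℕ p≡1+2h ⟨
    fromℕ p                               ≡⟨ fromℕp≡0 ⟩
    0#                                    ∎)
    where open ≡-Reasoning

  nonzero : List Carrier
  nonzero = remove 0# elements

  Unique-nonzero : Unique nonzero
  Unique-nonzero = Unique-remove elements Unique-elements

  ∈-nonzero : ∀ {x} → x ≢ 0# → x ∈ nonzero
  ∈-nonzero {x} x≢0 = ∈-remove⁺ elements (∈-elements x) x≢0

  nonzero-≢0 : ∀ {x} → x ∈ nonzero → x ≢ 0#
  nonzero-≢0 x∈ refl = ∉-remove elements Unique-elements x∈

  private
    q-odd : Σ ℕ λ h → q ≡ suc (2 ℕ.* h)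
    q-odd = ¬2∣n⇒odd (subst (λ n → ¬ (2 ∣ n)) (sym q≡p^k) (odd-prime^k∤2 p-prime p≢2 k))

  -- Opaque, so that goals mentioning m are not normalised through the parity argument on q.
  opaque
    m : ℕ
    m = proj₁ q-odd

    q≡1+2m : q ≡ suc (2 ℕ.* m)
    q≡1+2m = proj₂ q-odd

  length-nonzero : length nonzero ≡ 2 ℕ.* m
  length-nonzero = ℕ.suc-injective (begin
    suc (length nonzero)   ≡⟨ length-remove elements (∈-elements 0#) ⟨
    length elements        ≡⟨ length-elements ⟩
    q                      ≡⟨ q≡1+2m ⟩
    suc (2 ℕ.* m)          ∎)
    where open ≡-Reasoning

  Π : List Carrier → Carrier
  Π = Product.fold

  Π-involution : ∀ (σ : Carrier → Carrier) a xs → Unique xs →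
    (∀ {x} → x ∈ xs → σ x ∈ xs) → (∀ {x} → x ∈ xs → σ (σ x) ≡ x) →
    (∀ {x} → x ∈ xs → σ x ≢ x) → (∀ {x} → x ∈ xs → x * σ x ≡ a) →
    Σ ℕ λ j → length xs ≡ 2 ℕ.* j × Π xs ≡ a ^ j
  Π-involution σ a xs u closed involutive fixFree paired
    with Product.fold-involution σ a xs u closed involutive fixFree paired
  ... | j , length≡ , Π≡ = j , length≡ , trans Π≡ (power≡^ j)
    where
    power≡^ : ∀ n → a Product.^ n ≡ a ^ n
    power≡^ zero    = refl
    power≡^ (suc n) = cong (_*_ a) (power≡^ n)

  module NonzeroWithout± (b : Carrier) (b≢0 : b ≢ 0#) where
    b≢-b : b ≢ - b
    b≢-b b≡-b = two≢0 (linear-combination₂ (b ⁻¹) (- (1# + 1#))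
      (solve 2 (λ b b' → :2 := :0 :+ b' :* ((b :+ b) :- :0) :+ :- :2 :* (b :* b' :- :1)) refl b (b ⁻¹))
      (trans (cong (_+_ b) b≡-b) (-‿inverseʳ b)) (⁻¹-inverse b b≢0))

    rest : List Carrier
    rest = remove (- b) (remove b nonzero)

    Unique-rest : Unique rest
    Unique-rest = Unique-remove (remove b nonzero) (Unique-remove nonzero Unique-nonzero)

    ∈-rest⁻ : ∀ {x} → x ∈ rest → x ≢ 0# × x ≢ b × x ≢ - b
    ∈-rest⁻ x∈ =
      nonzero-≢0 (∈-remove⁻ nonzero x∈′) ,
      (λ { refl → ∉-remove nonzero Unique-nonzero x∈′ }) ,
      (λ { refl → ∉-remove (remove b nonzero) (Unique-remove nonzero Unique-nonzero) x∈ })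
      where x∈′ = ∈-remove⁻ (remove b nonzero) x∈

    ∈-rest⁺ : ∀ {x} → x ≢ 0# → x ≢ b → x ≢ - b → x ∈ rest
    ∈-rest⁺ x≢0 x≢b x≢-b = ∈-remove⁺ (remove b nonzero) (∈-remove⁺ nonzero (∈-nonzero x≢0) x≢b) x≢-b

    private
      -b∈ : - b ∈ remove b nonzero
      -b∈ = ∈-remove⁺ nonzero (∈-nonzero (-x≢0 b≢0)) (λ -b≡b → b≢-b (sym -b≡b))

    Π-nonzero : Π nonzero ≡ b * (- b * Π rest)
    Π-nonzero = trans (Product.fold-remove nonzero (∈-nonzero b≢0))
      (cong (_*_ b) (Product.fold-remove (remove b nonzero) -b∈))

    length-nonzero≡2+length-rest : length nonzero ≡ suc (suc (length rest))
    length-nonzero≡2+length-rest = trans (length-remove nonzero (∈-nonzero b≢0))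
      (cong suc (length-remove (remove b nonzero) -b∈))

  wilson : Π nonzero ≡ - 1#
  wilson = begin
    Π nonzero                   ≡⟨ Π-nonzero ⟩
    1# * (- 1# * Π rest)        ≡⟨ cong (λ x → 1# * (- 1# * x)) Π-rest≡1 ⟩
    1# * (- 1# * 1#)            ≡⟨ solve 0 (:1 :* (:- :1 :* :1) := :- :1) refl ⟩
    - 1#                        ∎
    where
    open ≡-Reasoning
    open NonzeroWithout± 1# 1≢0

    1⁻¹≡1 : 1# ⁻¹ ≡ 1#
    1⁻¹≡1 = sym (⁻¹-unique (*-identityˡ 1#))

    -1⁻¹≡-1 : (- 1#) ⁻¹ ≡ - 1#
    -1⁻¹≡-1 = sym (⁻¹-unique (solve 0 (:- :1 :* :- :1 := :1) refl))

    closed : ∀ {x} → x ∈ rest → x ⁻¹ ∈ rest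
    closed x∈ with ∈-rest⁻ x∈
    ... | x≢0 , x≢1 , x≢-1 = ∈-rest⁺ (x⁻¹≢0 x≢0)
          (λ x⁻¹≡1 → x≢1 (trans (sym (⁻¹-involutive x≢0)) (trans (cong _⁻¹ x⁻¹≡1) 1⁻¹≡1)))
          (λ x⁻¹≡-1 → x≢-1 (trans (sym (⁻¹-involutive x≢0)) (trans (cong _⁻¹ x⁻¹≡-1) -1⁻¹≡-1)))

    fixFree : ∀ {x} → x ∈ rest → x ⁻¹ ≢ x
    fixFree {x} x∈ x⁻¹≡x with ∈-rest⁻ x∈
    ... | x≢0 , x≢1 , x≢-1 with x*x≡y*y⇒x≡±y (trans (cong (_*_ x) (sym x⁻¹≡x))
                                  (trans (⁻¹-inverse x x≢0) (sym (*-identityˡ 1#))))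
    ...   | inj₁ x≡1  = x≢1 x≡1
    ...   | inj₂ x≡-1 = x≢-1 x≡-1

    pairing : Σ ℕ λ j → length rest ≡ 2 ℕ.* j × Π rest ≡ 1# ^ j
    pairing = Π-involution _⁻¹ 1# rest Unique-rest closed
      (λ x∈ → ⁻¹-involutive (proj₁ (∈-rest⁻ x∈))) fixFree
      (λ x∈ → ⁻¹-inverse _ (proj₁ (∈-rest⁻ x∈)))

    Π-rest≡1 : Π rest ≡ 1#
    Π-rest≡1 = trans (proj₂ (proj₂ pairing)) (^-zeroˡ (proj₁ pairing))

  module Dirichlet {a} (a≢0 : a ≢ 0#) where
    σ : Carrier → Carrier
    σ x = a * x ⁻¹

    σ≢0 : ∀ {x} → x ≢ 0# → σ x ≢ 0#
    σ≢0 x≢0 = x*y≢0 a≢0 (x⁻¹≢0 x≢0)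

    x*σx≡a : ∀ {x} → x ≢ 0# → x * σ x ≡ a
    x*σx≡a {x} x≢0 = linear-combination a
      (solve 3 (λ a x x' → x :* (a :* x') := a :+ a :* (x :* x' :- :1)) refl a x (x ⁻¹)) (⁻¹-inverse x x≢0)

    σ-involutive : ∀ {x} → x ≢ 0# → σ (σ x) ≡ x
    σ-involutive {x} x≢0 = sym (x*y≡z⇒x≡z*y⁻¹ (σ≢0 x≢0) (x*σx≡a x≢0))

    σx≡y⇒x*y≡a : ∀ {x y} → x ≢ 0# → σ x ≡ y → x * y ≡ a
    σx≡y⇒x*y≡a x≢0 σx≡y = trans (cong (_*_ _) (sym σx≡y)) (x*σx≡a x≢0)

  euler-nonsquare : ∀ {a} → a ≢ 0# → (∀ b → b * b ≢ a) → a ^ m ≡ - 1#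
  euler-nonsquare {a} a≢0 nonsquare = begin
    a ^ m        ≡⟨ cong (a ^_) j≡m ⟨
    a ^ j        ≡⟨ proj₂ (proj₂ pairing) ⟨
    Π nonzero    ≡⟨ wilson ⟩
    - 1#         ∎
    where
    open ≡-Reasoning
    open Dirichlet a≢0
    pairing : Σ ℕ λ j → length nonzero ≡ 2 ℕ.* j × Π nonzero ≡ a ^ j
    pairing = Π-involution σ a nonzero Unique-nonzero
      (λ x∈ → ∈-nonzero (σ≢0 (nonzero-≢0 x∈)))
      (λ x∈ → σ-involutive (nonzero-≢0 x∈))
      (λ {x} x∈ σx≡x → nonsquare x (σx≡y⇒x*y≡a (nonzero-≢0 x∈) σx≡x))
      (λ x∈ → x*σx≡a (nonzero-≢0 x∈))

    j : ℕ
    j = proj₁ pairing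

    j≡m : j ≡ m
    j≡m = ℕ.*-cancelˡ-≡ j m 2 (trans (sym (proj₁ (proj₂ pairing))) length-nonzero)

  euler-square : ∀ {b} → b ≢ 0# → (b * b) ^ m ≡ 1#
  euler-square {b} b≢0 = begin
    a ^ m                 ≡⟨ cong (a ^_) m≡1+j ⟩
    a * a ^ j             ≡⟨ linear-combination (- 1#)
                               (solve 2 (λ b r → b :* b :* r := :- :1 :* :- :1 :+ :- :1 :* (b :* (:- b :* r) :- :- :1))
                                 refl b (a ^ j))
                               b*[-b*a^j]≡-1 ⟩
    - 1# * - 1#           ≡⟨ solve 0 (:- :1 :* :- :1 := :1) refl ⟩
    1#                    ∎
    where
    open ≡-Reasoning

    a : Carrier
    a = b * b

    open Dirichlet (x*y≢0 b≢0 b≢0)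
    open NonzeroWithout± b b≢0

    closed : ∀ {x} → x ∈ rest → σ x ∈ rest
    closed {x} x∈ with ∈-rest⁻ x∈
    ... | x≢0 , x≢b , x≢-b = ∈-rest⁺ (σ≢0 x≢0)
          (λ σx≡b → x≢b (*-cancelˡ b≢0 (trans (*-comm b x) (σx≡y⇒x*y≡a x≢0 σx≡b))))
          (λ σx≡-b → x≢-b (*-cancelˡ (-x≢0 b≢0) (linear-combination 1#
             (solve 2 (λ b x → :- b :* x := :- b :* :- b :+ :1 :* (x :* :- b :- b :* b)) refl b x)
             (σx≡y⇒x*y≡a x≢0 σx≡-b))))

    fixFree : ∀ {x} → x ∈ rest → σ x ≢ x
    fixFree {x} x∈ σx≡x with ∈-rest⁻ x∈ | x*x≡y*y⇒x≡±y (σx≡y⇒x*y≡a (proj₁ (∈-rest⁻ x∈)) σx≡x)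
    ... | _ , x≢b , _    | inj₁ x≡b  = x≢b x≡b
    ... | _ , _ , x≢-b   | inj₂ x≡-b = x≢-b x≡-b

    pairing : Σ ℕ λ j → length rest ≡ 2 ℕ.* j × Π rest ≡ a ^ j
    pairing = Π-involution σ a rest Unique-rest closed
      (λ x∈ → σ-involutive (proj₁ (∈-rest⁻ x∈))) fixFree
      (λ x∈ → x*σx≡a (proj₁ (∈-rest⁻ x∈)))

    j : ℕ
    j = proj₁ pairing

    b*[-b*a^j]≡-1 : b * (- b * a ^ j) ≡ - 1#
    b*[-b*a^j]≡-1 = trans (cong (λ r → b * (- b * r)) (sym (proj₂ (proj₂ pairing))))
                      (trans (sym Π-nonzero) wilson)

    m≡1+j : m ≡ suc j
    m≡1+j = ℕ.*-cancelˡ-≡ m (suc j) 2 (begin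
      2 ℕ.* m                     ≡⟨ length-nonzero ⟨
      length nonzero              ≡⟨ length-nonzero≡2+length-rest ⟩
      suc (suc (length rest))     ≡⟨ cong (λ l → suc (suc l)) (proj₁ (proj₂ pairing)) ⟩
      suc (suc (2 ℕ.* j))         ≡⟨ ℕ.*-suc 2 j ⟨
      2 ℕ.* suc j                 ∎)

  legendre-nonzero : ∀ {a} → a ≢ 0# →
    ((Σ Carrier λ b → b * b ≡ a) × legendre a ≡ + 1) ⊎ ((∀ b → b * b ≢ a) × legendre a ≡ -[1+ 0 ])
  legendre-nonzero {a} a≢0 with a ≟ 0#
  ... | yes a≡0 = ⊥-elim (a≢0 a≡0)
  ... | no  _   with isSquare? a
  ...   | yes (i , e)  = inj₁ ((to i , e) , refl)
  ...   | no  ¬square = inj₂ ((λ b e → ¬square (Inverse.from enum b , trans (cong₂ _*_ (to-from b) (to-from b)) e)) , refl)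

  legendre≡1⇒≢0 : ∀ {a} → legendre a ≡ + 1 → a ≢ 0#
  legendre≡1⇒≢0 {a} leg≡1 a≡0 with a ≟ 0#
  legendre≡1⇒≢0 ()     a≡0 | yes _
  legendre≡1⇒≢0 leg≡1  a≡0 | no  a≢0 = a≢0 a≡0

  legendre-sign : ∀ {a} → a ≢ 0# → Sign (legendre a)
  legendre-sign a≢0 with legendre-nonzero a≢0
  ... | inj₁ (_ , leg≡1)  rewrite leg≡1  = plus
  ... | inj₂ (_ , leg≡-1) rewrite leg≡-1 = minus

  legendre-square : ∀ {b} → b ≢ 0# → legendre (b * b) ≡ + 1
  legendre-square {b} b≢0 with legendre-nonzero (x*y≢0 b≢0 b≢0)
  ... | inj₁ (_ , leg≡1)     = leg≡1
  ... | inj₂ (nonsquare , _) = ⊥-elim (nonsquare b refl)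

  euler : ∀ {a} → a ≢ 0# → a ^ m ≡ fromℤ (legendre a)
  euler a≢0 with legendre-nonzero a≢0
  ... | inj₁ ((b , refl) , leg≡1) = trans (euler-square (x*y≢0⇒x≢0 a≢0))
                                          (sym (trans (cong fromℤ leg≡1) (+-identityʳ 1#)))
  ... | inj₂ (nonsquare , leg≡-1) = trans (euler-nonsquare a≢0 nonsquare)
                                          (sym (trans (cong fromℤ leg≡-1) (cong -_ (+-identityʳ 1#))))

  legendre-* : ∀ {a b} → a ≢ 0# → b ≢ 0# → legendre (a * b) ≡ legendre a ℤ.* legendre b
  legendre-* {a} {b} a≢0 b≢0 = fromℤ-injective-on-signs two≢0
    (legendre-sign (x*y≢0 a≢0 b≢0)) (Sign-* (legendre-sign a≢0) (legendre-sign b≢0)) (begin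
      fromℤ (legendre (a * b))                  ≡⟨ euler (x*y≢0 a≢0 b≢0) ⟨
      (a * b) ^ m                               ≡⟨ ^-distribʳ-* a b m ⟩
      a ^ m * b ^ m                             ≡⟨ cong₂ _*_ (euler a≢0) (euler b≢0) ⟩
      fromℤ (legendre a) * fromℤ (legendre b)   ≡⟨ fromℤ-* (legendre a) (legendre b) ⟨
      fromℤ (legendre a ℤ.* legendre b)         ∎)
    where open ≡-Reasoning

  legendre-≡ : ∀ {a b s} → a * b ≡ s * s → s ≢ 0# → legendre a ≡ legendre b
  legendre-≡ {a} {b} {s} ab≡s² s≢0 = Sign-*≡1⇒≡ (legendre-sign a≢0) (legendre-sign b≢0) (begin
    legendre a ℤ.* legendre b     ≡⟨ legendre-* a≢0 b≢0 ⟨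
    legendre (a * b)              ≡⟨ cong legendre ab≡s² ⟩
    legendre (s * s)              ≡⟨ legendre-square s≢0 ⟩
    + 1                           ∎)
    where
    open ≡-Reasoning
    ab≢0 : a * b ≢ 0#
    ab≢0 ab≡0 = x*y≢0 s≢0 s≢0 (trans (sym ab≡s²) ab≡0)
    a≢0 : a ≢ 0#
    a≢0 = x*y≢0⇒x≢0 ab≢0
    b≢0 : b ≢ 0#
    b≢0 = x*y≢0⇒y≢0 ab≢0

  fermat : ∀ x → x ^ q ≡ x
  fermat x with x ≟ 0#
  ... | yes refl = trans (cong (0# ^_) q≡1+2m) (zeroˡ _)
  ... | no  x≢0  = begin
    x ^ q                                    ≡⟨ cong (x ^_) q≡1+2m ⟩
    x * x ^ (2 ℕ.* m)                        ≡⟨ cong (λ n → x * x ^ n) (ℕ.*-comm 2 m) ⟩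
    x * x ^ (m ℕ.* 2)                        ≡⟨ cong (_*_ x) (^-*-assoc x m 2) ⟨
    x * (x ^ m * (x ^ m * 1#))               ≡⟨ cong (λ s → x * (s * (s * 1#))) (euler x≢0) ⟩
    x * (fromℤ ℓ * (fromℤ ℓ * 1#))           ≡⟨ cong (λ s → x * (fromℤ ℓ * s)) (*-identityʳ _) ⟩
    x * (fromℤ ℓ * fromℤ ℓ)                  ≡⟨ cong (_*_ x) (fromℤ-sign² (legendre-sign x≢0)) ⟩
    x * 1#                                   ≡⟨ *-identityʳ x ⟩
    x                                        ∎
    where
    open ≡-Reasoning
    ℓ : ℤ
    ℓ = legendre x

  parity-of-m : (Σ ℕ λ j → m ≡ 2 ℕ.* j × legendre (- 1#) ≡ + 1)
              ⊎ (Σ ℕ λ j → m ≡ suc (2 ℕ.* j) × legendre (- 1#) ≡ -[1+ 0 ])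
  parity-of-m with even⊎odd m
  ... | inj₁ (j , m≡2j)   = inj₁ (j , m≡2j , fromℤ-injective-on-signs two≢0 (legendre-sign -1≢0) plus (begin
    fromℤ (legendre (- 1#))    ≡⟨ euler -1≢0 ⟨
    (- 1#) ^ m                 ≡⟨ cong ((- 1#) ^_) m≡2j ⟩
    (- 1#) ^ (2 ℕ.* j)         ≡⟨ -1^[2*j]≡1 j ⟩
    1#                         ≡⟨ +-identityʳ 1# ⟨
    1# + 0#                    ∎))
    where open ≡-Reasoning
  ... | inj₂ (j , m≡1+2j) = inj₂ (j , m≡1+2j , fromℤ-injective-on-signs two≢0 (legendre-sign -1≢0) minus (begin
    fromℤ (legendre (- 1#))    ≡⟨ euler -1≢0 ⟨
    (- 1#) ^ m                 ≡⟨ cong ((- 1#) ^_) m≡1+2j ⟩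
    - 1# * (- 1#) ^ (2 ℕ.* j)  ≡⟨ cong (_*_ (- 1#)) (-1^[2*j]≡1 j) ⟩
    - 1# * 1#                  ≡⟨ solve 0 (:- :1 :* :1 := :- (:1 :+ :0)) refl ⟩
    - (1# + 0#)                ∎))
    where open ≡-Reasoning


  private
    two : Carrier
    two = 1# + 1#

    ε : ℤ
    ε = legendre (- 1#)

    legendre[2x] : ∀ {x} → x ≢ 0# → legendre (two * x) ≡ legendre two ℤ.* legendre x
    legendre[2x] = legendre-* two≢0

    legendre[-2x] : ∀ {x} → x ≢ 0# → legendre (- 1# * (two * x)) ≡ ε ℤ.* (legendre two ℤ.* legendre x)
    legendre[-2x] x≢0 = trans (legendre-* -1≢0 (x*y≢0 two≢0 x≢0)) (cong (ε ℤ.*_) (legendre[2x] x≢0))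

  2x∈𝒜 : ∀ {x ℓ₋ ℓ₊} → 1# - x ≢ 0# → 1# + x ≢ 0# → legendre (1# - x) ≡ ℓ₋ → legendre (1# + x) ≡ ℓ₊ →
    𝒜 (- two) two (ε ℤ.* (legendre two ℤ.* ℓ₋)) (legendre two ℤ.* ℓ₊) (two * x)
  2x∈𝒜 {x} 1-x≢0 1+x≢0 refl refl =
    trans (cong legendre (solve 1 (λ x → :2 :* x :+ :- :2 := :- :1 :* (:2 :* (:1 :- x))) refl x)) (legendre[-2x] 1-x≢0) ,
    trans (cong legendre (solve 1 (λ x → :2 :* x :+ :2 := :2 :* (:1 :+ x)) refl x)) (legendre[2x] 1+x≢0)

  ±2e∈𝒜 : ∀ {e ℓ} → 1# - e ≢ 0# → 1# + e ≢ 0# → legendre (1# - e) ≡ ℓ → legendre (1# + e) ≡ ℓ →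
    ∀ s → s * s ≡ (two * e) * (two * e) → 𝒜 (- two) two (ε ℤ.* (legendre two ℤ.* ℓ)) (legendre two ℤ.* ℓ) s
  ±2e∈𝒜 {e} 1-e≢0 1+e≢0 legendre[1-e]≡ℓ legendre[1+e]≡ℓ s s²≡[2e]² with x*x≡y*y⇒x≡±y s²≡[2e]²
  ... | inj₁ refl = 2x∈𝒜 1-e≢0 1+e≢0 legendre[1-e]≡ℓ legendre[1+e]≡ℓ
  ... | inj₂ refl = subst (𝒜 (- two) two _ _) (solve 1 (λ e → :2 :* :- e := :- (:2 :* e)) refl e)
        (2x∈𝒜 (subst (_≢ 0#) 1+e≡1--e 1+e≢0) 1-e≢0
              (trans (cong legendre (sym 1+e≡1--e)) legendre[1+e]≡ℓ) legendre[1-e]≡ℓ)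
    where
    1+e≡1--e : 1# + e ≡ 1# - - e
    1+e≡1--e = solve 1 (λ e → :1 :+ e := :1 :- :- e) refl e

  module LegendreOnCircle {a b} (circle : a * a + b * b ≡ 1#) (a≢0 : a ≢ 0#) (b≢0 : b ≢ 0#) where
    open UnitCircle.Point (FiniteField.field′ F) circle

    private
      ν μ : ℤ
      ν = legendre (1# + a)
      μ = legendre (1# + b)

      [1-a][1+a]≢0 : (1# - a) * (1# + a) ≢ 0#
      [1-a][1+a]≢0 = subst (_≢ 0#) (sym [1-a][1+a]≡b²) (x*y≢0 b≢0 b≢0)

      [1-b][1+b]≢0 : (1# - b) * (1# + b) ≢ 0#
      [1-b][1+b]≢0 = subst (_≢ 0#) (sym [1-b][1+b]≡a²) (x*y≢0 a≢0 a≢0)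

    legendre[1-a]≡ν : legendre (1# - a) ≡ ν
    legendre[1-a]≡ν = legendre-≡ [1-a][1+a]≡b² b≢0

    legendre[1-b]≡μ : legendre (1# - b) ≡ μ
    legendre[1-b]≡μ = legendre-≡ [1-b][1+b]≡a² a≢0

    ν≡[2/q]μ : ν ≡ legendre two ℤ.* μ
    ν≡[2/q]μ = trans (legendre-≡ [1+a][2[1+b]]≡[1+a+b]² 1+a+b≢0) (legendre-* two≢0 (x*y≢0⇒y≢0 [1-b][1+b]≢0))
      where
      1+a+b≢0 : 1# + a + b ≢ 0#
      1+a+b≢0 1+a+b≡0 = x*y≢0 (x*y≢0⇒y≢0 [1-a][1+a]≢0) (x*y≢0 two≢0 (x*y≢0⇒y≢0 [1-b][1+b]≢0))
        (trans [1+a][2[1+b]]≡[1+a+b]² (trans (cong (λ x → x * x) 1+a+b≡0) (zeroˡ 0#)))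

    √[2[a²-b²]+2]∈𝒜 : ∀ s → s * s ≡ two * (a * a - b * b) + two → 𝒜 (- two) two (ε ℤ.* μ) μ s
    √[2[a²-b²]+2]∈𝒜 s s²≡ = subst (λ l → 𝒜 (- two) two (ε ℤ.* l) l s) [2/q]ν≡μ
      (±2e∈𝒜 (x*y≢0⇒x≢0 [1-a][1+a]≢0) (x*y≢0⇒y≢0 [1-a][1+a]≢0) legendre[1-a]≡ν refl s (trans s²≡ 2[a²-b²]+2≡[2a]²))
      where
      [2/q]ν≡μ : legendre two ℤ.* ν ≡ μ
      [2/q]ν≡μ = trans (cong (legendre two ℤ.*_) ν≡[2/q]μ) (Sign-*-cancelˡ (legendre-sign two≢0) μ)

    √[2-2[a²-b²]]∈𝒜 : ∀ s → s * s ≡ two - two * (a * a - b * b) → 𝒜 (- two) two (ε ℤ.* ν) ν s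
    √[2-2[a²-b²]]∈𝒜 s s²≡ = subst (λ l → 𝒜 (- two) two (ε ℤ.* l) l s) (sym ν≡[2/q]μ)
      (±2e∈𝒜 (x*y≢0⇒x≢0 [1-b][1+b]≢0) (x*y≢0⇒y≢0 [1-b][1+b]≢0) legendre[1-b]≡μ refl s (trans s²≡ 2-2[a²-b²]≡[2b]²))

-- The power u^((q − ε)/4)

module QuarticCharacter {q} (F : FiniteField q) {p k} (p-prime : Prime p) (p≢2 : p ≢ 2) (q≡p^k : q ≡ p ℕ.^ k)
                        {L : Field} (h : FieldHom (FiniteField.field′ F) L) where
  private
    module K = FiniteFieldTheory F {k = k} p-prime p≢2 q≡p^k
  open FieldProperties L
  open FieldHomProperties h
  open Frobenius L

  ι-fermat : ∀ x → ι x ^ q ≡ ι x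
  ι-fermat x = trans (sym (ι-^ x q)) (cong ι (K.fermat x))

  frobenius-q : ∀ x y → (x + y) ^ q ≡ x ^ q + y ^ q
  frobenius-q x y rewrite q≡p^k = frobenius-+ p-prime (trans (sym (ι-fromℕ p)) (trans (cong ι K.fromℕp≡0) ι-0)) k x y

  module _ {a b} (circle : a K.* a K.+ b K.* b ≡ K.1#) (a≢0 : a ≢ K.0#) (b≢0 : b ≢ K.0#)
           {u} (u≢0 : u ≢ 0#) (u+u⁻¹≡ : u + u ⁻¹ ≡ ι ((K.1# K.+ K.1#) K.* (a K.* a K.- b K.* b))) where
    private
      A B : Carrier
      A = ι a
      B = ι b

      ι-two : ι (K.1# K.+ K.1#) ≡ 1# + 1#
      ι-two = trans (ι-+ _ _) (cong₂ _+_ ι-1 ι-1)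

      circleL : A * A + B * B ≡ 1#
      circleL = trans (cong₂ _+_ (sym (ι-* a a)) (sym (ι-* b b))) (trans (sym (ι-+ _ _)) (trans (cong ι circle) ι-1))

      u+u⁻¹≡2[A²-B²] : u + u ⁻¹ ≡ (1# + 1#) * (A * A - B * B)
      u+u⁻¹≡2[A²-B²] = trans u+u⁻¹≡ (trans (ι-* _ _) (cong₂ _*_ ι-two
        (trans (ι-+ _ _) (cong₂ _+_ (ι-* a a) (trans (ι-neg _) (cong -_ (ι-* b b)))))))

      2AB≢0 : (1# + 1#) * A * B ≢ 0#
      2AB≢0 = subst (_≢ 0#) (trans (ι-* _ _) (cong₂ _*_ (trans (ι-* _ _) (cong₂ _*_ ι-two refl)) refl))
        (ι-≢0 (K.x*y≢0 (K.x*y≢0 K.two≢0 a≢0) b≢0))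

    open UnitCircle.Point L circleL
    open SquareRoot u≢0 u+u⁻¹≡2[A²-B²] 2AB≢0
    open GaussianSquare i*i≡-1

    private
      X Y w g M : Carrier
      X = 1# + A + B
      Y = 1# - A + B
      w = X + Y * i
      g = (1# + 1#) * (1# + 1#) * (1# + B)
      M = ι (K.fromℤ (K.legendre (K.1# K.+ b)))

      u*g²≡w⁴ : u * (g * g) ≡ (w * w) * (w * w)
      u*g²≡w⁴ = begin
        u * (g * g)                               ≡⟨ cong (λ v → v * (g * g)) [a+bi]²≡u ⟨
        (A + B * i) * (A + B * i) * (g * g)       ≡⟨ solve 2 (λ v g → v :* v :* (g :* g) := (g :* v) :* (g :* v)) refl (A + B * i) g ⟩
        (g * (A + B * i)) * (g * (A + B * i))     ≡⟨ cong₂ _*_ [X+Yi]²≡4[1+b][a+bi] [X+Yi]²≡4[1+b][a+bi] ⟨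
        (w * w) * (w * w)                         ∎
        where open ≡-Reasoning

      ι[1+x+y] : ∀ x y → ι (K.1# K.+ x K.+ y) ≡ 1# + ι x + ι y
      ι[1+x+y] x y = trans (ι-+ _ _) (cong (_+ ι y) (trans (ι-+ _ _) (cong (_+ ι x) ι-1)))

      X^q≡X : X ^ q ≡ X
      X^q≡X = subst (λ X → X ^ q ≡ X) (ι[1+x+y] a b) (ι-fermat _)

      Y^q≡Y : Y ^ q ≡ Y
      Y^q≡Y = subst (λ Y → Y ^ q ≡ Y) (trans (ι[1+x+y] (K.- a) b) (cong (λ A′ → 1# + A′ + B) (ι-neg a))) (ι-fermat _)

      w^q≡X+Yi^q : w ^ q ≡ X + Y * i ^ q
      w^q≡X+Yi^q = begin
        (X + Y * i) ^ q          ≡⟨ frobenius-q X (Y * i) ⟩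
        X ^ q + (Y * i) ^ q      ≡⟨ cong (_+_ (X ^ q)) (^-distribʳ-* Y i q) ⟩
        X ^ q + Y ^ q * i ^ q    ≡⟨ cong₂ (λ X′ Y′ → X′ + Y′ * i ^ q) X^q≡X Y^q≡Y ⟩
        X + Y * i ^ q            ∎
        where open ≡-Reasoning

      ĝ : K.Carrier
      ĝ = (K.1# K.+ K.1#) K.* (K.1# K.+ K.1#) K.* (K.1# K.+ b)

      ι-ĝ : ι ĝ ≡ g
      ι-ĝ = trans (ι-* _ _) (cong₂ _*_ (trans (ι-* _ _) (cong₂ _*_ ι-two ι-two)) (trans (ι-+ _ _) (cong (_+ B) ι-1)))

      1+b≢0 : K.1# K.+ b ≢ K.0#
      1+b≢0 = K.x*y≢0⇒y≢0 (subst (_≢ K.0#) (sym [1-b][1+b]≡a²ᶠ) (K.x*y≢0 a≢0 a≢0))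
        where open UnitCircle.Point (FiniteField.field′ F) circle using () renaming ([1-b][1+b]≡a² to [1-b][1+b]≡a²ᶠ)

      ĝ≢0 : ĝ ≢ K.0#
      ĝ≢0 = K.x*y≢0 (K.x*y≢0 K.two≢0 K.two≢0) 1+b≢0

      g≢0 : g ≢ 0#
      g≢0 = subst (_≢ 0#) ι-ĝ (ι-≢0 ĝ≢0)

      μ-sign : Sign (K.legendre (K.1# K.+ b))
      μ-sign = K.legendre-sign 1+b≢0

      g^m≡M : g ^ K.m ≡ M
      g^m≡M = begin
        g ^ K.m                          ≡⟨ cong (_^ K.m) ι-ĝ ⟨
        ι ĝ ^ K.m                        ≡⟨ ι-^ ĝ K.m ⟨
        ι (ĝ K.^ K.m)                    ≡⟨ cong ι (K.euler ĝ≢0) ⟩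
        ι (K.fromℤ (K.legendre ĝ))       ≡⟨ cong (λ l → ι (K.fromℤ l)) (K.legendre-≡ ĝ[1+b]≡[2[1+b]]² (K.x*y≢0 K.two≢0 1+b≢0)) ⟩
        M                                ∎
        where
        open ≡-Reasoning
        ĝ[1+b]≡[2[1+b]]² : ĝ K.* (K.1# K.+ b) ≡ ((K.1# K.+ K.1#) K.* (K.1# K.+ b)) K.* ((K.1# K.+ K.1#) K.* (K.1# K.+ b))
        ĝ[1+b]≡[2[1+b]]² = K.solve 1 (λ b → K.:2 K.:* K.:2 K.:* (K.:1 K.:+ b) K.:* (K.:1 K.:+ b)
                                          K.:= (K.:2 K.:* (K.:1 K.:+ b)) K.:* (K.:2 K.:* (K.:1 K.:+ b))) refl b

      x*M≡1⇒x≡M : ∀ {x} → x * M ≡ 1# → x ≡ M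
      x*M≡1⇒x≡M {x} x*M≡1 = trans (x*s≡1⇒x≡s μ-sign (trans (cong (_*_ x) (sym ι-fromℤ-μ)) x*M≡1)) (sym ι-fromℤ-μ)
        where
        ι-fromℤ-μ : M ≡ fromℤ (K.legendre (K.1# K.+ b))
        ι-fromℤ-μ = ι-fromℤ (K.legendre (K.1# K.+ b))

      w≢0 : w ≢ 0#
      w≢0 w≡0 = x*y≢0 g≢0 (λ v≡0 → u≢0 (trans (sym [a+bi]²≡u) (trans (cong (λ v → v * v) v≡0) (zeroˡ 0#))))
        (trans (sym [X+Yi]²≡4[1+b][a+bi]) (trans (cong (λ x → x * x) w≡0) (zeroˡ 0#)))

      u^e*g^[2e]≡w^[4e] : ∀ e → u ^ e * g ^ (2 ℕ.* e) ≡ w ^ (4 ℕ.* e)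
      u^e*g^[2e]≡w^[4e] = x[y*y]≡[z*z][z*z]⇒x^e*y^[2e]≡z^[4e] u*g²≡w⁴

      -- q ≡ 1 (mod 4): i is fixed by Frobenius, so w^(q-1) = 1.
      u^j≡M-if-m≡2j : ∀ {j} → K.m ≡ 2 ℕ.* j → u ^ j ≡ M
      u^j≡M-if-m≡2j {j} m≡2j = x*M≡1⇒x≡M (begin
        u ^ j * M                        ≡⟨ cong (_*_ (u ^ j)) g^m≡M ⟨
        u ^ j * g ^ K.m                  ≡⟨ cong (λ n → u ^ j * g ^ n) m≡2j ⟩
        u ^ j * g ^ (2 ℕ.* j)            ≡⟨ u^e*g^[2e]≡w^[4e] j ⟩
        w ^ (4 ℕ.* j)                    ≡⟨ w^[4j]≡1 ⟩
        1#                               ∎)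
        where
        open ≡-Reasoning
        q≡1+4j : q ≡ suc (4 ℕ.* j)
        q≡1+4j = trans K.q≡1+2m (cong suc (trans (cong (2 ℕ.*_) m≡2j) (sym (ℕ.*-assoc 2 2 j))))
        i^q≡i : i ^ q ≡ i
        i^q≡i = begin
          i ^ q                    ≡⟨ cong (i ^_) q≡1+4j ⟩
          i * i ^ (4 ℕ.* j)        ≡⟨ cong (_*_ i) (x*x≡-1⇒x^[4*j]≡1 i*i≡-1 j) ⟩
          i * 1#                   ≡⟨ *-identityʳ i ⟩
          i                        ∎
        w^[4j]≡1 : w ^ (4 ℕ.* j) ≡ 1#
        w^[4j]≡1 = *-cancelˡ w≢0 (begin
          w * w ^ (4 ℕ.* j)        ≡⟨ cong (w ^_) q≡1+4j ⟨
          w ^ q                    ≡⟨ w^q≡X+Yi^q ⟩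
          X + Y * i ^ q            ≡⟨ cong (λ z → X + Y * z) i^q≡i ⟩
          w                        ≡⟨ *-identityʳ w ⟨
          w * 1#                   ∎)

      -- q ≡ 3 (mod 4): Frobenius conjugates i, so w^(q+1) is the norm X² + Y² = g.
      u^[1+j]≡M-if-m≡1+2j : ∀ {j} → K.m ≡ suc (2 ℕ.* j) → u ^ suc j ≡ M
      u^[1+j]≡M-if-m≡1+2j {j} m≡1+2j = x*M≡1⇒x≡M (*-cancelˡ g≢0 (begin
        g * (u ^ suc j * M)                     ≡⟨ solve 3 (λ g x m → g :* (x :* m) := x :* (g :* m)) refl g (u ^ suc j) M ⟩
        u ^ suc j * (g * M)                     ≡⟨ cong (λ z → u ^ suc j * (g * z)) g^m≡M ⟨
        u ^ suc j * (g * g ^ K.m)               ≡⟨ cong (λ n → u ^ suc j * g ^ n) 1+m≡2[1+j] ⟩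
        u ^ suc j * g ^ (2 ℕ.* suc j)           ≡⟨ u^e*g^[2e]≡w^[4e] (suc j) ⟩
        w ^ (4 ℕ.* suc j)                       ≡⟨ cong (w ^_) 4[1+j]≡1+q ⟩
        w * w ^ q                               ≡⟨ cong (_*_ w) w^q≡X+Yi^q ⟩
        w * (X + Y * i ^ q)                     ≡⟨ cong (λ z → w * (X + Y * z)) i^q≡-i ⟩
        w * (X + Y * - i)                       ≡⟨ [X+Yi][X-Yi]≡4[1+b] ⟩
        g                                       ≡⟨ *-identityʳ g ⟨
        g * 1#                                  ∎))
        where
        open ≡-Reasoning
        1+m≡2[1+j] : suc K.m ≡ 2 ℕ.* suc j
        1+m≡2[1+j] = trans (cong suc m≡1+2j) (sym (ℕ.*-suc 2 j))

        q≡3+4j : q ≡ 3 ℕ.+ 4 ℕ.* j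
        q≡3+4j = trans K.q≡1+2m (trans (cong (λ n → suc (2 ℕ.* n)) m≡1+2j) (1+2[1+2n]≡3+4n j))
          where
          1+2[1+2n]≡3+4n : ∀ n → suc (2 ℕ.* suc (2 ℕ.* n)) ≡ 3 ℕ.+ 4 ℕ.* n
          1+2[1+2n]≡3+4n = solve-∀

        4[1+j]≡1+q : 4 ℕ.* suc j ≡ suc q
        4[1+j]≡1+q = trans (ℕ.*-suc 4 j) (cong suc (sym q≡3+4j))

        i^q≡-i : i ^ q ≡ - i
        i^q≡-i = begin
          i ^ q                            ≡⟨ cong (i ^_) q≡3+4j ⟩
          i * (i * (i * i ^ (4 ℕ.* j)))    ≡⟨ cong (λ z → i * (i * (i * z))) (x*x≡-1⇒x^[4*j]≡1 i*i≡-1 j) ⟩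
          i * (i * (i * 1#))               ≡⟨ linear-combination i
                                                (solve 1 (λ i → i :* (i :* (i :* :1)) := :- i :+ i :* (i :* i :- :- :1)) refl i)
                                                i*i≡-1 ⟩
          - i                              ∎

    u^[|q-ε|/4]≡[1+b/q] : u ^ (∣ + q ℤ.- K.legendre (K.- K.1#) ∣ ℕ./ 4) ≡ ι (K.fromℤ (K.legendre (K.1# K.+ b)))
    u^[|q-ε|/4]≡[1+b/q] with K.parity-of-m
    ... | inj₁ (j , m≡2j , ε≡1) = trans (cong (u ^_) (trans
            (cong₂ (λ n ε′ → ∣ + n ℤ.- ε′ ∣ ℕ./ 4) (trans K.q≡1+2m (cong (λ n → suc (2 ℕ.* n)) m≡2j)) ε≡1)
            (∣[1+4j]-1∣/4≡j j)))
          (u^j≡M-if-m≡2j {j} m≡2j)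
    ... | inj₂ (j , m≡1+2j , ε≡-1) = trans (cong (u ^_) (trans
            (cong₂ (λ n ε′ → ∣ + n ℤ.- ε′ ∣ ℕ./ 4) (trans K.q≡1+2m (cong (λ n → suc (2 ℕ.* n)) m≡1+2j)) ε≡-1)
            (∣[3+4j]+1∣/4≡1+j j)))
          (u^[1+j]≡M-if-m≡1+2j {j} m≡1+2j)

proposition8p5 : (q : ℕ) → IsOddPrimePower q → (F : FiniteField q) →
  let open FiniteField F
      ε = legendre (- 1#)
      two = 1# + 1#
  in (τ : Carrier) → legendre τ ≡ + 1 → legendre (τ + 1#) ≡ + 1 →
     (L : Field) → (h : FieldHom (FiniteField.field′ F) L) →
     (u : Field.Carrier L) → u ≢ Field.0# L →
     Field._+_ L u (Field._⁻¹ L u) ≡ FieldHom.ι h (two * (1# - τ) * (1# + τ) ⁻¹) →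
     (c : Carrier) → c * c ≡ 1# + τ →
     (c′ : Carrier) → c′ * c′ ≡ 1# + τ ⁻¹ →
     let r = two * (1# - τ) * (1# + τ) ⁻¹
         ν = legendre (1# + c ⁻¹)
         μ = legendre (1# + c′ ⁻¹)
     in (legendre (1# - c ⁻¹) ≡ ν) × (legendre (1# - c′ ⁻¹) ≡ μ)
        × (ν ≡ legendre two ℤ.* μ)
        × (∀ s → s * s ≡ r + two → 𝒜 (- two) two (ε ℤ.* μ) μ s)
        × (∀ s → s * s ≡ two - r → 𝒜 (- two) two (ε ℤ.* ν) ν s)
        × (Field._^_ L u (∣ + q ℤ.- ε ∣ ℕ./ 4) ≡ FieldHom.ι h (fromℤ μ))
proposition8p5 q (p , k , p-prime , p≢2 , _ , q≡p^k) F τ τ-square τ+1-square L h u u≢0 u+u⁻¹≡r c c*c≡1+τ c′ c′*c′≡1+τ⁻¹ =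
  legendre[1-a]≡ν , legendre[1-b]≡μ , ν≡[2/q]μ ,
  (λ s s²≡r+2 → √[2[a²-b²]+2]∈𝒜 s (trans s²≡r+2 (cong (_+ (1# + 1#)) r≡2[c⁻²-c′⁻²]))) ,
  (λ s s²≡2-r → √[2-2[a²-b²]]∈𝒜 s (trans s²≡2-r (cong (_-_ (1# + 1#)) r≡2[c⁻²-c′⁻²]))) ,
  u^[|q-ε|/4]≡[1+b/q] circle (x⁻¹≢0 c≢0) (x⁻¹≢0 c′≢0) u≢0 (trans u+u⁻¹≡r (cong (FieldHom.ι h) r≡2[c⁻²-c′⁻²]))
  where
  open FiniteFieldTheory F {k = k} p-prime p≢2 q≡p^k
  open TauParametrisation.Roots (FiniteField.field′ F) (legendre≡1⇒≢0 τ-square)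
    (λ 1+τ≡0 → legendre≡1⇒≢0 τ+1-square (trans (+-comm τ 1#) 1+τ≡0)) c*c≡1+τ c′*c′≡1+τ⁻¹
  open LegendreOnCircle circle (x⁻¹≢0 c≢0) (x⁻¹≢0 c′≢0)
  open QuarticCharacter F {k = k} p-prime p≢2 q≡p^k h
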